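{- If $L$ is an integral lattice which represents $A_8$ imprimitively, then $L$ is isometric to $E_8\perp N$ for some integral lattice $N$.
   Context: Lattices are finitely generated $\mathbb{Z}$-modules on positive definite quadratic spaces over $\mathbb{Q}$ with quadratic map $Q$ and bilinear form $B$; integral means $B(L,L)\subseteq\mathbb{Z}$. A representation $\sigma:M\to L$ is a linear map preserving $Q$; $L$ represents $M$ imprimitively if there is a representation $\sigma$ with $\mathbb{Q}\sigma(M)\cap L\ne\sigma(M)$. $A_8=\{(a_0,\dots,a_8)\in\mathbb{Z}^9:\sum a_i=0\}$ with the dot product. $E_8$ is the unique (up to isometry) even unimodular lattice of rank $8$. $\perp$ denotes orthogonal sum. -}

module Defs where

open import Data.Nat using (ℕ; _+_)
open import Data.Integer as ℤ using (ℤ; +_; -[1+_]; _*_; _>_)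
open import Data.Fin using (Fin; splitAt)
open import Data.Sum using (inj₁; inj₂)
open import Data.Vec using (Vec; []; _∷_; lookup; zipWith; map; foldr′; tabulate; replicate)
open import Data.Product using (Σ; _×_; ∃; ∃-syntax; proj₁)
open import Relation.Binary.PropositionalEquality using (_≡_; _≢_)
open import Relation.Nullary using (¬_)

-- Integer vectors (coordinates w.r.t. a fixed Z-basis of a lattice).
ℤ^ : ℕ → Set
ℤ^ n = Vec ℤ n

Σℤ : ∀ {n} → Vec ℤ n → ℤ
Σℤ = foldr′ ℤ._+_ (+ 0)

_⊞_ : ∀ {n} → ℤ^ n → ℤ^ n → ℤ^ n
_⊞_ = zipWith ℤ._+_

_·ᵥ_ : ∀ {n} → ℤ → ℤ^ n → ℤ^ n
k ·ᵥ x = map (k *_) x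

0ᵥ : ∀ {n} → ℤ^ n
0ᵥ = replicate _ (+ 0)

-- Gram matrix of a lattice of rank n with respect to a Z-basis.
-- Integral lattice: all entries B(e_i,e_j) lie in Z.
Gram : ℕ → Set
Gram n = Fin n → Fin n → ℤ

B : ∀ {n} → Gram n → ℤ^ n → ℤ^ n → ℤ
B {n} G x y = Σℤ (tabulate λ i → Σℤ (tabulate λ j → lookup x i * G i j * lookup y j))

Q : ∀ {n} → Gram n → ℤ^ n → ℤ
Q G x = B G x x

IsSymmetric : ∀ {n} → Gram n → Set
IsSymmetric G = ∀ i j → G i j ≡ G j i

IsPosDef : ∀ {n} → Gram n → Set
IsPosDef {n} G = ∀ (x : ℤ^ n) → x ≢ 0ᵥ → Q G x > + 0

IsIntegralLattice : ∀ {n} → Gram n → Set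
IsIntegralLattice G = IsSymmetric G × IsPosDef G

_⊥ᴳ_ : ∀ {a b} → Gram a → Gram b → Gram (a + b)
_⊥ᴳ_ {a} {b} G H i j with splitAt a i | splitAt a j
... | inj₁ i′ | inj₁ j′ = G i′ j′
... | inj₂ i′ | inj₂ j′ = H i′ j′
... | inj₁ _  | inj₂ _  = + 0
... | inj₂ _  | inj₁ _  = + 0

-- Additive maps Z^n → Z^k (these are exactly the Z-linear maps).
IsAdditive : ∀ {n k} → (ℤ^ n → ℤ^ k) → Set
IsAdditive f = ∀ x y → f (x ⊞ y) ≡ f x ⊞ f y

Isometric : ∀ {n k} → Gram n → Gram k → Set
Isometric {n} {k} G H =
  Σ (ℤ^ n → ℤ^ k) λ f → Σ (ℤ^ k → ℤ^ n) λ g →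
    IsAdditive f × (∀ x → g (f x) ≡ x) × (∀ y → f (g y) ≡ y)
    × (∀ x y → B H (f x) (f y) ≡ B G x y)

-- E8: Gram matrix = Cartan matrix of E8 (Bourbaki labelling 1..8 ↦ 0..7),
-- the unique even unimodular lattice of rank 8.
E8rows : Vec (Vec ℤ 8) 8
E8rows =
  (+ 2 ∷ + 0 ∷ -[1+ 0 ] ∷ + 0 ∷ + 0 ∷ + 0 ∷ + 0 ∷ + 0 ∷ []) ∷
  (+ 0 ∷ + 2 ∷ + 0 ∷ -[1+ 0 ] ∷ + 0 ∷ + 0 ∷ + 0 ∷ + 0 ∷ []) ∷
  (-[1+ 0 ] ∷ + 0 ∷ + 2 ∷ -[1+ 0 ] ∷ + 0 ∷ + 0 ∷ + 0 ∷ + 0 ∷ []) ∷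
  (+ 0 ∷ -[1+ 0 ] ∷ -[1+ 0 ] ∷ + 2 ∷ -[1+ 0 ] ∷ + 0 ∷ + 0 ∷ + 0 ∷ []) ∷
  (+ 0 ∷ + 0 ∷ + 0 ∷ -[1+ 0 ] ∷ + 2 ∷ -[1+ 0 ] ∷ + 0 ∷ + 0 ∷ []) ∷
  (+ 0 ∷ + 0 ∷ + 0 ∷ + 0 ∷ -[1+ 0 ] ∷ + 2 ∷ -[1+ 0 ] ∷ + 0 ∷ []) ∷
  (+ 0 ∷ + 0 ∷ + 0 ∷ + 0 ∷ + 0 ∷ -[1+ 0 ] ∷ + 2 ∷ -[1+ 0 ] ∷ []) ∷
  (+ 0 ∷ + 0 ∷ + 0 ∷ + 0 ∷ + 0 ∷ + 0 ∷ -[1+ 0 ] ∷ + 2 ∷ []) ∷ []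

E8 : Gram 8
E8 i j = lookup (lookup E8rows i) j

A8 : Set
A8 = Σ (ℤ^ 9) λ a → Σℤ a ≡ + 0

Q₉ : ℤ^ 9 → ℤ
Q₉ a = Σℤ (zipWith _*_ a a)

IsRepA8 : ∀ {n} → Gram n → (A8 → ℤ^ n) → Set
IsRepA8 G σ =
  (∀ (a b c : A8) → proj₁ c ≡ proj₁ a ⊞ proj₁ b → σ c ≡ σ a ⊞ σ b)
  × (∀ (a : A8) → Q G (σ a) ≡ Q₉ (proj₁ a))

-- σ(A8) ≠ Qσ(A8) ∩ L : some x ∈ L has a nonzero multiple in σ(A8)
-- but is not itself in σ(A8).
IsImprimitive : ∀ {n} → (A8 → ℤ^ n) → Set
IsImprimitive {n} σ =
  ∃[ x ] ∃[ k ] (k ≢ + 0) × (∃[ a ] σ a ≡ k ·ᵥ x) × ¬ (∃[ a ] σ a ≡ x)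

RepresentsA8Imprimitively : ∀ {n} → Gram n → Set
RepresentsA8Imprimitively {n} G =
  ∃[ σ ] IsRepA8 {n} G σ × IsImprimitive σ

-- Write k x = σ a with x ∉ σ(A8) and let tᵢ = B(x, σ(eᵢ − e₈)), so that k t = a − a₈𝟙.
-- With T = Σ tᵢ this gives 9x = σ(9t − T𝟙), and comparing the norms of both sides yields
-- T² = 9 (t·t − Q x). Hence 3 ∣ T and 3x = σ ê for ê = 3t − (T/3)𝟙. As x ∉ σ(A8), T/3 is
-- prime to 3, so ±ê ≡ γ = (1,1,1,1,1,1,−2,−2,−2) modulo 3·A8, which produces z ∈ L with
-- 3z = σ γ. Adjoining z to seven roots of σ(A8) gives vectors with the Cartan matrix of E8
-- as Gram matrix. E8 is unimodular, so their span is an orthogonal summand of L; a basis of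
-- the complement comes from Euclidean changes of coordinates.

module Submission where

open import Defs
open import Data.Nat using (ℕ)
open import Data.Product using (Σ; _×_; ∃; ∃-syntax)

open import Data.Nat as ℕ using (zero; suc)
open import Data.Nat.Properties as ℕ using ()
open import Data.Nat.Divisibility as ℕ using ()
open import Data.Nat.Primality using (Prime; euclidsLemma; prime?)
open import Data.Integer as ℤ using (ℤ; +_; -[1+_]; 0ℤ; 1ℤ; -1ℤ; _+_; _*_; -_; _-_; _>_; ∣_∣)
open import Data.Integer.Properties
open import Data.Integer.DivMod using (_/_; _%_; a≡a%n+[a/n]*n; n%d<d)
open import Data.Integer.Divisibility.Signed using (_∣_; divides; ∣ᵤ⇒∣; ∣⇒∣ᵤ)
open import Data.Integer.Tactic.RingSolver using (solve-∀)
open import Data.Fin using (Fin; zero; suc; fromℕ; splitAt; _↑ˡ_; _↑ʳ_)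
open import Data.Fin.Properties using (all?; splitAt⁻¹-↑ˡ; splitAt⁻¹-↑ʳ)
open import Data.Vec using (Vec; []; _∷_; head; tail; lookup; tabulate; zipWith; map; _++_; take; drop)
open import Data.Vec.Properties
  using ( lookup∘tabulate; tabulate∘lookup; tabulate-cong; lookup-zipWith; lookup-map; lookup-replicate
        ; zipWith-identityˡ; zipWith-++; take++drop≡id; ++-injective; take-zipWith; drop-zipWith)
open import Data.Product using (_,_; proj₁; proj₂)
open import Data.Sum using (_⊎_; inj₁; inj₂; [_,_]′)
open import Data.Empty using (⊥-elim)
open import Function using (_∘_)
open import Relation.Binary.PropositionalEquality
open import Relation.Nullary using (yes; no)
open import Relation.Nullary.Decidable using (from-yes; toWitness)
open import Axiom.UniquenessOfIdentityProofs using (module Decidable⇒UIP)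
open import Algebra.Properties.Semiring.Sum +-*-semiring
  using (sum; sum-syntax; sum-cong-≗; sum-replicate-zero; ∑-distrib-+; ∑-comm; *-distribˡ-sum; *-distribʳ-sum)
open import Algebra.Properties.AbelianGroup +-0-abelianGroup using (identityˡ-unique; ∙-cancelˡ; ∙-cancelʳ)
open ≡-Reasoning

Σℤ-tabulate : ∀ {n} (f : Fin n → ℤ) → Σℤ (tabulate f) ≡ sum f
Σℤ-tabulate {zero}  f = refl
Σℤ-tabulate {suc n} f = cong (_+_ (f zero)) (Σℤ-tabulate (f ∘ suc))

∑-cong-+ : ∀ {n} {f g h : Fin n → ℤ} → (∀ i → f i ≡ g i + h i) → sum f ≡ sum g + sum h
∑-cong-+ {g = g} {h} p = trans (sum-cong-≗ p) (∑-distrib-+ g h)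

∑-cong-* : ∀ {n} k {f g : Fin n → ℤ} → (∀ i → f i ≡ k * g i) → sum f ≡ k * sum g
∑-cong-* k {g = g} p = trans (sum-cong-≗ p) (sym (*-distribˡ-sum k g))

∑-zero : ∀ {n} {f : Fin n → ℤ} → (∀ i → f i ≡ 0ℤ) → sum f ≡ 0ℤ
∑-zero {n} p = trans (sum-cong-≗ p) (sum-replicate-zero n)

δ : ∀ {n} → Fin n → Fin n → ℤ
δ zero    zero    = 1ℤ
δ zero    (suc j) = 0ℤ
δ (suc i) zero    = 0ℤ
δ (suc i) (suc j) = δ i j

∑-δ : ∀ {n} (i : Fin n) (f : Fin n → ℤ) → ∑[ j < n ] (δ i j * f j) ≡ f i
∑-δ {suc n} zero f = begin
  1ℤ * f zero + ∑[ j < n ] (0ℤ * f (suc j)) ≡⟨ cong (_+_ (1ℤ * f zero)) (∑-zero (λ j → *-zeroˡ (f (suc j)))) ⟩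
  1ℤ * f zero + 0ℤ                         ≡⟨ +-identityʳ _ ⟩
  1ℤ * f zero                              ≡⟨ *-identityˡ _ ⟩
  f zero                                   ∎
∑-δ {suc n} (suc i) f = trans (+-identityˡ _) (∑-δ i (f ∘ suc))

lookup-ext : ∀ {n} {x y : ℤ^ n} → (∀ i → lookup x i ≡ lookup y i) → x ≡ y
lookup-ext {x = x} {y} p = begin
  x                  ≡⟨ tabulate∘lookup x ⟨
  tabulate (lookup x) ≡⟨ tabulate-cong p ⟩
  tabulate (lookup y) ≡⟨ tabulate∘lookup y ⟩
  y                  ∎

lookup-⊞ : ∀ {n} (x y : ℤ^ n) i → lookup (x ⊞ y) i ≡ lookup x i + lookup y i
lookup-⊞ x y i = lookup-zipWith _+_ i x y

lookup-·ᵥ : ∀ {n} k (x : ℤ^ n) i → lookup (k ·ᵥ x) i ≡ k * lookup x i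
lookup-·ᵥ k x i = lookup-map i (k *_) x

lookup-0ᵥ : ∀ {n} (i : Fin n) → lookup 0ᵥ i ≡ 0ℤ
lookup-0ᵥ i = lookup-replicate i 0ℤ

e : ∀ {n} → Fin n → ℤ^ n
e zero    = 1ℤ ∷ 0ᵥ
e (suc i) = 0ℤ ∷ e i

lookup-e : ∀ {n} (i j : Fin n) → lookup (e i) j ≡ δ i j
lookup-e zero    zero    = refl
lookup-e zero    (suc j) = lookup-0ᵥ j
lookup-e (suc i) zero    = refl
lookup-e (suc i) (suc j) = lookup-e i j

infixl 6 _⊟_

_⊟_ : ∀ {n} → ℤ^ n → ℤ^ n → ℤ^ n
_⊟_ = zipWith _-_

⊞-identityˡ : ∀ {n} (x : ℤ^ n) → 0ᵥ ⊞ x ≡ x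
⊞-identityˡ = zipWith-identityˡ +-identityˡ

⊞-identityʳ : ∀ {n} (x : ℤ^ n) → x ⊞ 0ᵥ ≡ x
⊞-identityʳ []       = refl
⊞-identityʳ (x ∷ xs) = cong₂ _∷_ (+-identityʳ x) (⊞-identityʳ xs)

⊞-⊟-cancelʳ : ∀ {n} (x y : ℤ^ n) → y ⊞ (x ⊟ y) ≡ x
⊞-⊟-cancelʳ []       []       = refl
⊞-⊟-cancelʳ (x ∷ xs) (y ∷ ys) = cong₂ _∷_ (cancel x y) (⊞-⊟-cancelʳ xs ys)
  where
  cancel : ∀ x y → y + (x - y) ≡ x
  cancel = solve-∀

⊞-⊟-cancelˡ : ∀ {n} (x y : ℤ^ n) → (x ⊞ y) ⊟ x ≡ y
⊞-⊟-cancelˡ []       []       = refl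
⊞-⊟-cancelˡ (x ∷ xs) (y ∷ ys) = cong₂ _∷_ (cancel x y) (⊞-⊟-cancelˡ xs ys)
  where
  cancel : ∀ x y → (x + y) - x ≡ y
  cancel = solve-∀

⊞-⊟-interchange : ∀ {n} (a b c d : ℤ^ n) → (a ⊞ b) ⊟ (c ⊞ d) ≡ (a ⊟ c) ⊞ (b ⊟ d)
⊞-⊟-interchange []       []       []       []       = refl
⊞-⊟-interchange (a ∷ as) (b ∷ bs) (c ∷ cs) (d ∷ ds) = cong₂ _∷_ (interchange a b c d) (⊞-⊟-interchange as bs cs ds)
  where
  interchange : ∀ a b c d → (a + b) - (c + d) ≡ (a - c) + (b - d)
  interchange = solve-∀

⊞-interchange : ∀ {n} (a b c d : ℤ^ n) → (a ⊞ b) ⊞ (c ⊞ d) ≡ (a ⊞ c) ⊞ (b ⊞ d)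
⊞-interchange []       []       []       []       = refl
⊞-interchange (a ∷ as) (b ∷ bs) (c ∷ cs) (d ∷ ds) = cong₂ _∷_ (interchange a b c d) (⊞-interchange as bs cs ds)
  where
  interchange : ∀ a b c d → (a + b) + (c + d) ≡ (a + c) + (b + d)
  interchange = solve-∀

·ᵥ-distribˡ : ∀ {n} k (x y : ℤ^ n) → k ·ᵥ (x ⊞ y) ≡ (k ·ᵥ x) ⊞ (k ·ᵥ y)
·ᵥ-distribˡ k []       []       = refl
·ᵥ-distribˡ k (x ∷ xs) (y ∷ ys) = cong₂ _∷_ (*-distribˡ-+ k x y) (·ᵥ-distribˡ k xs ys)

·ᵥ-distribʳ : ∀ {n} k l (x : ℤ^ n) → (k + l) ·ᵥ x ≡ (k ·ᵥ x) ⊞ (l ·ᵥ x)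
·ᵥ-distribʳ k l []       = refl
·ᵥ-distribʳ k l (x ∷ xs) = cong₂ _∷_ (*-distribʳ-+ x k l) (·ᵥ-distribʳ k l xs)

·ᵥ-assoc : ∀ {n} k l (x : ℤ^ n) → k ·ᵥ (l ·ᵥ x) ≡ (k * l) ·ᵥ x
·ᵥ-assoc k l []       = refl
·ᵥ-assoc k l (x ∷ xs) = cong₂ _∷_ (sym (*-assoc k l x)) (·ᵥ-assoc k l xs)

·ᵥ-comm : ∀ {n} k l (x : ℤ^ n) → k ·ᵥ (l ·ᵥ x) ≡ l ·ᵥ (k ·ᵥ x)
·ᵥ-comm k l x = trans (·ᵥ-assoc k l x) (trans (cong (_·ᵥ x) (*-comm k l)) (sym (·ᵥ-assoc l k x)))

·ᵥ-identity : ∀ {n} (x : ℤ^ n) → 1ℤ ·ᵥ x ≡ x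
·ᵥ-identity []       = refl
·ᵥ-identity (x ∷ xs) = cong₂ _∷_ (*-identityˡ x) (·ᵥ-identity xs)

·ᵥ-cancel : ∀ {n} k → k ≢ 0ℤ → (x y : ℤ^ n) → k ·ᵥ x ≡ k ·ᵥ y → x ≡ y
·ᵥ-cancel k k≢0 x y eq = lookup-ext λ i →
  *-cancelˡ-≡ k (lookup x i) (lookup y i) {{ℤ.≢-nonZero k≢0}}
    (trans (sym (lookup-·ᵥ k x i)) (trans (cong (λ w → lookup w i) eq) (lookup-·ᵥ k y i)))

Σℤ-⊞ : ∀ {n} (x y : ℤ^ n) → Σℤ (x ⊞ y) ≡ Σℤ x + Σℤ y
Σℤ-⊞ []       []       = refl
Σℤ-⊞ (x ∷ xs) (y ∷ ys) = trans (cong (_+_ (x + y)) (Σℤ-⊞ xs ys)) (interchange x y (Σℤ xs) (Σℤ ys))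
  where
  interchange : ∀ a b c d → (a + b) + (c + d) ≡ (a + c) + (b + d)
  interchange = solve-∀

Σℤ-⊟ : ∀ {n} (x y : ℤ^ n) → Σℤ (x ⊟ y) ≡ Σℤ x - Σℤ y
Σℤ-⊟ []       []       = refl
Σℤ-⊟ (x ∷ xs) (y ∷ ys) = trans (cong (_+_ (x - y)) (Σℤ-⊟ xs ys)) (interchange x y (Σℤ xs) (Σℤ ys))
  where
  interchange : ∀ a b c d → (a - b) + (c - d) ≡ (a + c) - (b + d)
  interchange = solve-∀

Σℤ-·ᵥ : ∀ {n} k (x : ℤ^ n) → Σℤ (k ·ᵥ x) ≡ k * Σℤ x
Σℤ-·ᵥ k []       = sym (*-zeroʳ k)
Σℤ-·ᵥ k (x ∷ xs) = trans (cong (_+_ (k * x)) (Σℤ-·ᵥ k xs)) (sym (*-distribˡ-+ k x (Σℤ xs)))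

Σℤ-e : ∀ {n} (i : Fin n) → Σℤ (e i) ≡ 1ℤ
Σℤ-e {suc n} zero    = trans (cong (_+_ 1ℤ) (Σℤ-0ᵥ n)) (+-identityʳ 1ℤ)
  where
  Σℤ-0ᵥ : ∀ n → Σℤ (0ᵥ {n}) ≡ 0ℤ
  Σℤ-0ᵥ zero    = refl
  Σℤ-0ᵥ (suc n) = trans (+-identityˡ _) (Σℤ-0ᵥ n)
Σℤ-e         (suc i) = trans (+-identityˡ _) (Σℤ-e i)

take-drop-++ : ∀ {m n} (p : ℤ^ m) (q : ℤ^ n) → take m (p ++ q) ≡ p × drop m (p ++ q) ≡ q
take-drop-++ {m} p q = ++-injective (take m (p ++ q)) p (take++drop≡id m (p ++ q))

e-↑ˡ : ∀ {a} b (i : Fin a) → e {a ℕ.+ b} (i ↑ˡ b) ≡ e i ++ 0ᵥ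
e-↑ˡ {suc a} b zero    = cong (1ℤ ∷_) (zeros-++ a b)
  where
  zeros-++ : ∀ a b → 0ᵥ {a ℕ.+ b} ≡ 0ᵥ {a} ++ 0ᵥ {b}
  zeros-++ zero    b = refl
  zeros-++ (suc a) b = cong (0ℤ ∷_) (zeros-++ a b)
e-↑ˡ {suc a} b (suc i) = cong (0ℤ ∷_) (e-↑ˡ b i)

e-↑ʳ : ∀ a {b} (j : Fin b) → e {a ℕ.+ b} (a ↑ʳ j) ≡ 0ᵥ ++ e j
e-↑ʳ zero    j = refl
e-↑ʳ (suc a) j = cong (0ℤ ∷_) (e-↑ʳ a j)

infix 7 _·_

_·_ : ∀ {n} → ℤ^ n → ℤ^ n → ℤ
a · b = Σℤ (zipWith _*_ a b)

·-sum : ∀ {n} (a b : ℤ^ n) → a · b ≡ ∑[ i < n ] (lookup a i * lookup b i)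
·-sum []       []       = refl
·-sum (a ∷ as) (b ∷ bs) = cong (_+_ (a * b)) (·-sum as bs)

·-⊟ʳ : ∀ {n} (a b c : ℤ^ n) → a · (b ⊟ c) ≡ a · b - a · c
·-⊟ʳ []       []       []       = refl
·-⊟ʳ (a ∷ as) (b ∷ bs) (c ∷ cs) = trans (cong (_+_ (a * (b - c))) (·-⊟ʳ as bs cs)) (distrib a b c (as · bs) (as · cs))
  where
  distrib : ∀ a b c x y → a * (b - c) + (x - y) ≡ (a * b + x) - (a * c + y)
  distrib = solve-∀

·-e : ∀ {n} (a : ℤ^ n) i → a · e i ≡ lookup a i
·-e {n} a i = begin
  a · e i                             ≡⟨ ·-sum a (e i) ⟩
  ∑[ j < n ] (lookup a j * lookup (e i) j) ≡⟨ sum-cong-≗ (λ j → trans (cong (lookup a j *_) (lookup-e i j)) (*-comm (lookup a j) (δ i j))) ⟩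
  ∑[ j < n ] (δ i j * lookup a j)      ≡⟨ ∑-δ i (lookup a) ⟩
  lookup a i                          ∎

·-⊞-square : ∀ {n} (a b : ℤ^ n) → (a ⊞ b) · (a ⊞ b) ≡ a · a + + 2 * (a · b) + b · b
·-⊞-square []       []       = refl
·-⊞-square (a ∷ as) (b ∷ bs) = trans (cong (_+_ ((a + b) * (a + b))) (·-⊞-square as bs)) (expand a b (as · as) (as · bs) (bs · bs))
  where
  expand : ∀ a b x y z → (a + b) * (a + b) + (x + + 2 * y + z) ≡ (a * a + x) + + 2 * (a * b + y) + (b * b + z)
  expand = solve-∀

affine : ∀ {n} → ℤ → ℤ → ℤ^ n → ℤ^ n
affine c d = map λ tᵢ → c * tᵢ - d

lookup-affine : ∀ {n} c d (t : ℤ^ n) i → lookup (affine c d t) i ≡ c * lookup t i - d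
lookup-affine c d t i = lookup-map i (λ tᵢ → c * tᵢ - d) t

Σℤ-affine : ∀ {n} c d (t : ℤ^ n) → Σℤ (affine c d t) ≡ c * Σℤ t - + n * d
Σℤ-affine c d []       = sym (expand c d)
  where
  expand : ∀ c d → c * 0ℤ - 0ℤ * d ≡ 0ℤ
  expand = solve-∀
Σℤ-affine {suc n} c d (t ∷ ts) = trans (cong (_+_ (c * t - d)) (Σℤ-affine c d ts)) (expand c d t (Σℤ ts) (+ n))
  where
  expand : ∀ c d t s m → (c * t - d) + (c * s - m * d) ≡ c * (t + s) - (1ℤ + m) * d
  expand = solve-∀

·-affine : ∀ {n} c d (t : ℤ^ n) →
  affine c d t · affine c d t ≡ c * c * (t · t) - + 2 * c * d * Σℤ t + + n * (d * d)
·-affine c d []       = sym (expand c d)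
  where
  expand : ∀ c d → c * c * 0ℤ - + 2 * c * d * 0ℤ + 0ℤ * (d * d) ≡ 0ℤ
  expand = solve-∀
·-affine {suc n} c d (t ∷ ts) = trans (cong (_+_ ((c * t - d) * (c * t - d))) (·-affine c d ts))
  (expand c d t (ts · ts) (Σℤ ts) (+ n))
  where
  expand : ∀ c d t q s m → (c * t - d) * (c * t - d) + (c * c * q - + 2 * c * d * s + m * (d * d))
                         ≡ c * c * (t * t + q) - + 2 * c * d * (t + s) + (1ℤ + m) * (d * d)
  expand = solve-∀

IsAdditiveFunctional : ∀ {n} → (ℤ^ n → ℤ) → Set
IsAdditiveFunctional φ = ∀ x y → φ (x ⊞ y) ≡ φ x + φ y

idempotent⇒0 : ∀ a → a + a ≡ a → a ≡ 0ℤ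
idempotent⇒0 a = identityˡ-unique a a

ℤ-additive⇒linear : (α : ℤ → ℤ) → (∀ k l → α (k + l) ≡ α k + α l) → ∀ k → α k ≡ k * α 1ℤ
ℤ-additive⇒linear α hom (+ n)    = additive-ℕ n
  where
  α0≡0 : α 0ℤ ≡ 0ℤ
  α0≡0 = idempotent⇒0 (α 0ℤ) (sym (hom 0ℤ 0ℤ))
  additive-ℕ : ∀ n → α (+ n) ≡ + n * α 1ℤ
  additive-ℕ zero    = trans α0≡0 (sym (*-zeroˡ (α 1ℤ)))
  additive-ℕ (suc n) = begin
    α (1ℤ + + n)          ≡⟨ hom 1ℤ (+ n) ⟩
    α 1ℤ + α (+ n)        ≡⟨ cong (_+_ (α 1ℤ)) (additive-ℕ n) ⟩
    α 1ℤ + + n * α 1ℤ     ≡⟨ step (+ n) (α 1ℤ) ⟩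
    (1ℤ + + n) * α 1ℤ     ∎
    where
    step : ∀ m a → a + m * a ≡ (1ℤ + m) * a
    step = solve-∀
ℤ-additive⇒linear α hom -[1+ n ] = begin
  α -[1+ n ]                                  ≡⟨ add-sub (α -[1+ n ]) (α (+ suc n)) ⟩
  (α -[1+ n ] + α (+ suc n)) - α (+ suc n)    ≡⟨ cong (_- α (+ suc n)) (hom -[1+ n ] (+ suc n)) ⟨
  α (-[1+ n ] + + suc n) - α (+ suc n)        ≡⟨ cong₂ _-_ α-inverse (ℤ-additive⇒linear α hom (+ suc n)) ⟩
  0ℤ - + suc n * α 1ℤ                         ≡⟨ neg-* (+ suc n) (α 1ℤ) ⟩
  -[1+ n ] * α 1ℤ                             ∎
  where
  add-sub : ∀ a b → a ≡ (a + b) - b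
  add-sub = solve-∀
  neg-* : ∀ m a → 0ℤ - m * a ≡ (- m) * a
  neg-* = solve-∀
  α-inverse : α (-[1+ n ] + + suc n) ≡ 0ℤ
  α-inverse = trans (cong α (+-inverseˡ (+ suc n))) (idempotent⇒0 (α 0ℤ) (sym (hom 0ℤ 0ℤ)))

additive⇒basis-expansion : ∀ {n} (φ : ℤ^ n → ℤ) → IsAdditiveFunctional φ →
  ∀ x → φ x ≡ ∑[ i < n ] (lookup x i * φ (e i))
additive⇒basis-expansion {zero}  φ add [] = idempotent⇒0 (φ []) (sym (add [] []))
additive⇒basis-expansion {suc n} φ add (x ∷ xs) = begin
  φ (x ∷ xs)                           ≡⟨ cong φ (cong₂ _∷_ (+-identityʳ x) (⊞-identityˡ xs)) ⟨
  φ ((x ∷ 0ᵥ) ⊞ (0ℤ ∷ xs))             ≡⟨ add (x ∷ 0ᵥ) (0ℤ ∷ xs) ⟩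
  φ (x ∷ 0ᵥ) + φ (0ℤ ∷ xs)             ≡⟨ cong₂ _+_ (ℤ-additive⇒linear α α-add x) (additive⇒basis-expansion ψ ψ-add xs) ⟩
  x * φ (e zero) + ∑[ i < n ] (lookup xs i * φ (e (suc i))) ∎
  where
  α : ℤ → ℤ
  α k = φ (k ∷ 0ᵥ)
  α-add : ∀ k l → α (k + l) ≡ α k + α l
  α-add k l = trans (cong (λ z → φ ((k + l) ∷ z)) (sym (⊞-identityˡ 0ᵥ))) (add (k ∷ 0ᵥ) (l ∷ 0ᵥ))
  ψ : ℤ^ n → ℤ
  ψ ys = φ (0ℤ ∷ ys)
  ψ-add : IsAdditiveFunctional ψ
  ψ-add xs ys = add (0ℤ ∷ xs) (0ℤ ∷ ys)

additive⇒dot : ∀ {n} (φ : ℤ^ n → ℤ) → IsAdditiveFunctional φ →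
  ∀ x → φ x ≡ tabulate (φ ∘ e) · x
additive⇒dot {n} φ add x = begin
  φ x                                                   ≡⟨ additive⇒basis-expansion φ add x ⟩
  ∑[ i < n ] (lookup x i * φ (e i))                     ≡⟨ sum-cong-≗ (λ i → trans (cong (_* lookup x i) (lookup∘tabulate (φ ∘ e) i)) (*-comm (φ (e i)) (lookup x i))) ⟨
  ∑[ i < n ] (lookup (tabulate (φ ∘ e)) i * lookup x i) ≡⟨ ·-sum (tabulate (φ ∘ e)) x ⟨
  tabulate (φ ∘ e) · x                                  ∎

additive⇒0 : ∀ {k n} (f : ℤ^ k → ℤ^ n) → IsAdditive f → f 0ᵥ ≡ 0ᵥ
additive⇒0 f add = lookup-ext λ i → trans (idempotent⇒0 _ (begin
  lookup (f 0ᵥ) i + lookup (f 0ᵥ) i ≡⟨ lookup-⊞ (f 0ᵥ) (f 0ᵥ) i ⟨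
  lookup (f 0ᵥ ⊞ f 0ᵥ) i            ≡⟨ cong (λ z → lookup z i) (add 0ᵥ 0ᵥ) ⟨
  lookup (f (0ᵥ ⊞ 0ᵥ)) i            ≡⟨ cong (λ z → lookup (f z) i) (⊞-identityˡ 0ᵥ) ⟩
  lookup (f 0ᵥ) i                   ∎)) (sym (lookup-0ᵥ i))

functional-⊟ : ∀ {n} (φ : ℤ^ n → ℤ) → IsAdditiveFunctional φ → ∀ x y → φ (x ⊟ y) ≡ φ x - φ y
functional-⊟ φ add x y = begin
  φ (x ⊟ y)                  ≡⟨ add-sub (φ (x ⊟ y)) (φ y) ⟩
  (φ y + φ (x ⊟ y)) - φ y    ≡⟨ cong (_- φ y) (add y (x ⊟ y)) ⟨
  φ (y ⊞ (x ⊟ y)) - φ y      ≡⟨ cong (λ z → φ z - φ y) (⊞-⊟-cancelʳ x y) ⟩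
  φ x - φ y                  ∎
  where
  add-sub : ∀ a b → a ≡ (b + a) - b
  add-sub = solve-∀

lincomb : ∀ {r n} → (Fin r → ℤ^ n) → ℤ^ r → ℤ^ n
lincomb {r} v a = tabulate λ p → ∑[ l < r ] (lookup a l * lookup (v l) p)

lincomb-add : ∀ {r n} (v : Fin r → ℤ^ n) → IsAdditive (lincomb v)
lincomb-add {r} v a b = lookup-ext λ p → begin
  lookup (lincomb v (a ⊞ b)) p                           ≡⟨ lookup∘tabulate _ p ⟩
  ∑[ l < r ] (lookup (a ⊞ b) l * lookup (v l) p)         ≡⟨ ∑-cong-+ (λ l → trans (cong (_* lookup (v l) p) (lookup-⊞ a b l)) (*-distribʳ-+ _ (lookup a l) _)) ⟩
  ∑[ l < r ] (lookup a l * lookup (v l) p) + ∑[ l < r ] (lookup b l * lookup (v l) p)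
                                                         ≡⟨ cong₂ _+_ (lookup∘tabulate _ p) (lookup∘tabulate _ p) ⟨
  lookup (lincomb v a) p + lookup (lincomb v b) p        ≡⟨ lookup-⊞ (lincomb v a) (lincomb v b) p ⟨
  lookup (lincomb v a ⊞ lincomb v b) p                   ∎

lincomb-e : ∀ {r n} (v : Fin r → ℤ^ n) i → lincomb v (e i) ≡ v i
lincomb-e v i = lookup-ext λ p → trans (lookup∘tabulate _ p)
  (trans (sum-cong-≗ λ l → cong (_* lookup (v l) p) (lookup-e i l)) (∑-δ i (λ l → lookup (v l) p)))

functional-lincomb : ∀ {r n} (φ : ℤ^ n → ℤ) → IsAdditiveFunctional φ → (v : Fin r → ℤ^ n) →
  ∀ a → φ (lincomb v a) ≡ ∑[ l < r ] (lookup a l * φ (v l))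
functional-lincomb φ add v a =
  trans (additive⇒basis-expansion (φ ∘ lincomb v) (λ x y → trans (cong φ (lincomb-add v x y)) (add _ _)) a)
        (sum-cong-≗ λ l → cong (λ z → lookup a l * φ z) (lincomb-e v l))

module _ {n} (G : Gram n) where

  B-sum : ∀ x y → B G x y ≡ ∑[ i < n ] ∑[ j < n ] (lookup x i * G i j * lookup y j)
  B-sum x y = trans (Σℤ-tabulate (λ i → Σℤ (tabulate (entry i))))
                    (sum-cong-≗ λ i → Σℤ-tabulate (entry i))
    where
    entry : Fin n → Fin n → ℤ
    entry i j = lookup x i * G i j * lookup y j

  private
    B-entrywise-+ : ∀ x y x′ y′ x″ y″ →
      (∀ i j → lookup x i * G i j * lookup y j ≡ lookup x′ i * G i j * lookup y′ j + lookup x″ i * G i j * lookup y″ j) →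
      B G x y ≡ B G x′ y′ + B G x″ y″
    B-entrywise-+ x y x′ y′ x″ y″ p = begin
      B G x y                   ≡⟨ B-sum x y ⟩
      _                         ≡⟨ ∑-cong-+ (λ i → ∑-cong-+ (p i)) ⟩
      _                         ≡⟨ cong₂ _+_ (B-sum x′ y′) (B-sum x″ y″) ⟨
      B G x′ y′ + B G x″ y″     ∎

    B-entrywise-* : ∀ k x y x′ y′ →
      (∀ i j → lookup x i * G i j * lookup y j ≡ k * (lookup x′ i * G i j * lookup y′ j)) →
      B G x y ≡ k * B G x′ y′
    B-entrywise-* k x y x′ y′ p = begin
      B G x y       ≡⟨ B-sum x y ⟩
      _             ≡⟨ ∑-cong-* k (λ i → ∑-cong-* k (p i)) ⟩
      _             ≡⟨ cong (k *_) (B-sum x′ y′) ⟨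
      k * B G x′ y′ ∎

  B-⊞ˡ : ∀ x y z → B G (x ⊞ y) z ≡ B G x z + B G y z
  B-⊞ˡ x y z = B-entrywise-+ (x ⊞ y) z x z y z λ i j →
    trans (cong (λ t → t * G i j * lookup z j) (lookup-⊞ x y i)) (distrib (lookup x i) (lookup y i) (G i j) (lookup z j))
    where
    distrib : ∀ a b g c → (a + b) * g * c ≡ a * g * c + b * g * c
    distrib = solve-∀

  B-⊞ʳ : ∀ x y z → B G x (y ⊞ z) ≡ B G x y + B G x z
  B-⊞ʳ x y z = B-entrywise-+ x (y ⊞ z) x y x z λ i j →
    trans (cong (λ t → lookup x i * G i j * t) (lookup-⊞ y z j)) (*-distribˡ-+ (lookup x i * G i j) (lookup y j) (lookup z j))

  B-·ˡ : ∀ k x y → B G (k ·ᵥ x) y ≡ k * B G x y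
  B-·ˡ k x y = B-entrywise-* k (k ·ᵥ x) y x y λ i j →
    trans (cong (λ t → t * G i j * lookup y j) (lookup-·ᵥ k x i)) (assoc k (lookup x i) (G i j) (lookup y j))
    where
    assoc : ∀ k a g c → k * a * g * c ≡ k * (a * g * c)
    assoc = solve-∀

  B-·ʳ : ∀ k x y → B G x (k ·ᵥ y) ≡ k * B G x y
  B-·ʳ k x y = B-entrywise-* k x (k ·ᵥ y) x y λ i j →
    trans (cong (λ t → lookup x i * G i j * t) (lookup-·ᵥ k y j)) (assoc k (lookup x i) (G i j) (lookup y j))
    where
    assoc : ∀ k a g c → a * g * (k * c) ≡ k * (a * g * c)
    assoc = solve-∀

  B-sym : IsSymmetric G → ∀ x y → B G x y ≡ B G y x
  B-sym sym-G x y = begin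
    B G x y                                                   ≡⟨ B-sum x y ⟩
    ∑[ i < n ] ∑[ j < n ] (lookup x i * G i j * lookup y j)   ≡⟨ ∑-comm (λ i j → lookup x i * G i j * lookup y j) ⟩
    ∑[ j < n ] ∑[ i < n ] (lookup x i * G i j * lookup y j)   ≡⟨ sum-cong-≗ (λ j → sum-cong-≗ λ i → swap-ends {lookup x i} {lookup y j} (sym-G i j)) ⟩
    ∑[ j < n ] ∑[ i < n ] (lookup y j * G j i * lookup x i)   ≡⟨ B-sum y x ⟨
    B G y x                                                   ∎
    where
    swap-ends : ∀ {a b g h} → g ≡ h → a * g * b ≡ b * h * a
    swap-ends {a} {b} {g} refl = comm a b g
      where
      comm : ∀ a b g → a * g * b ≡ b * g * a
      comm = solve-∀

Q-⊞ : ∀ {n} (G : Gram n) → IsSymmetric G → ∀ x y → Q G (x ⊞ y) ≡ Q G x + + 2 * B G x y + Q G y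
Q-⊞ G G-sym x y = begin
  B G (x ⊞ y) (x ⊞ y)                              ≡⟨ B-⊞ˡ G x y (x ⊞ y) ⟩
  B G x (x ⊞ y) + B G y (x ⊞ y)                    ≡⟨ cong₂ _+_ (B-⊞ʳ G x x y) (B-⊞ʳ G y x y) ⟩
  (B G x x + B G x y) + (B G y x + B G y y)        ≡⟨ cong (λ w → (B G x x + B G x y) + (w + B G y y)) (B-sym G G-sym y x) ⟩
  (B G x x + B G x y) + (B G x y + B G y y)        ≡⟨ collect (B G x x) (B G x y) (B G y y) ⟩
  B G x x + + 2 * B G x y + B G y y                ∎
  where
  collect : ∀ p q r → (p + q) + (q + r) ≡ p + + 2 * q + r
  collect = solve-∀

B-cong : ∀ {n} {G H : Gram n} → (∀ i j → G i j ≡ H i j) → ∀ x y → B G x y ≡ B H x y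
B-cong {G = G} {H} G≗H x y = begin
  B G x y ≡⟨ B-sum G x y ⟩
  _       ≡⟨ sum-cong-≗ (λ i → sum-cong-≗ λ j → cong (λ t → lookup x i * t * lookup y j) (G≗H i j)) ⟩
  _       ≡⟨ B-sum H x y ⟨
  B H x y ∎

pullback : ∀ {k n} → Gram n → (ℤ^ k → ℤ^ n) → Gram k
pullback G g i j = B G (g (e i)) (g (e j))

B-pullback : ∀ {k n} (G : Gram n) (g : ℤ^ k → ℤ^ n) → IsAdditive g →
  ∀ u w → B G (g u) (g w) ≡ B (pullback G g) u w
B-pullback {k} G g add u w = begin
  B G (g u) (g w)                                                        ≡⟨ additive⇒basis-expansion _ add₁ u ⟩
  ∑[ i < k ] (lookup u i * B G (g (e i)) (g w))                          ≡⟨ sum-cong-≗ (λ i → cong (lookup u i *_) (additive⇒basis-expansion _ (add₂ i) w)) ⟩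
  ∑[ i < k ] (lookup u i * ∑[ j < k ] (lookup w j * pullback G g i j))   ≡⟨ sum-cong-≗ (λ i → ∑-cong-* (lookup u i) (λ j → reorder (lookup u i) (lookup w j) _)) ⟨
  ∑[ i < k ] ∑[ j < k ] (lookup u i * pullback G g i j * lookup w j)     ≡⟨ B-sum (pullback G g) u w ⟨
  B (pullback G g) u w                                                   ∎
  where
  add₁ : IsAdditiveFunctional (λ t → B G (g t) (g w))
  add₁ s t = trans (cong (λ z → B G z (g w)) (add s t)) (B-⊞ˡ G (g s) (g t) (g w))
  add₂ : ∀ i → IsAdditiveFunctional (λ t → B G (g (e i)) (g t))
  add₂ i s t = trans (cong (B G (g (e i))) (add s t)) (B-⊞ʳ G (g (e i)) (g s) (g t))
  reorder : ∀ a b c → a * c * b ≡ a * (b * c)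
  reorder = solve-∀

pullback-isIntegralLattice : ∀ {k n} (G : Gram n) (g : ℤ^ k → ℤ^ n) → IsIntegralLattice G →
  IsAdditive g → (∀ w → g w ≡ 0ᵥ → w ≡ 0ᵥ) → IsIntegralLattice (pullback G g)
pullback-isIntegralLattice G g (sym-G , pos-G) add inj =
  (λ i j → B-sym G sym-G (g (e i)) (g (e j))) ,
  (λ w w≢0 → subst (_> 0ℤ) (B-pullback G g add w w) (pos-G (g w) (w≢0 ∘ inj w)))

isometric-by-basis : ∀ {n k} (G : Gram n) (H : Gram k) (f : ℤ^ n → ℤ^ k) (g : ℤ^ k → ℤ^ n) →
  IsAdditive f → IsAdditive g → (∀ x → g (f x) ≡ x) → (∀ y → f (g y) ≡ y) →
  (∀ i j → B G (g (e i)) (g (e j)) ≡ H i j) → Isometric G H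
isometric-by-basis G H f g f-add g-add g∘f f∘g gram =
  f , g , f-add , g∘f , f∘g , λ x y → begin
    B H (f x) (f y)                   ≡⟨ B-cong gram (f x) (f y) ⟨
    B (pullback G g) (f x) (f y)      ≡⟨ B-pullback G g g-add (f x) (f y) ⟨
    B G (g (f x)) (g (f y))           ≡⟨ cong₂ (B G) (g∘f x) (g∘f y) ⟩
    B G x y                           ∎

⊥ᴳ-blocks : ∀ {a b} (G : Gram a) (H : Gram b) (F : Gram (a ℕ.+ b)) →
  (∀ i j → F (i ↑ˡ b) (j ↑ˡ b) ≡ G i j) → (∀ i j → F (i ↑ˡ b) (a ↑ʳ j) ≡ 0ℤ) →
  (∀ i j → F (a ↑ʳ i) (j ↑ˡ b) ≡ 0ℤ) → (∀ i j → F (a ↑ʳ i) (a ↑ʳ j) ≡ H i j) →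
  ∀ i j → F i j ≡ (G ⊥ᴳ H) i j
⊥ᴳ-blocks {a} {b} G H F GG GH HG HH i j with splitAt a i in eqi | splitAt a j in eqj
... | inj₁ i′ | inj₁ j′ = subst₂ (λ s t → F s t ≡ G i′ j′) (splitAt⁻¹-↑ˡ eqi) (splitAt⁻¹-↑ˡ eqj) (GG i′ j′)
... | inj₁ i′ | inj₂ j′ = subst₂ (λ s t → F s t ≡ 0ℤ) (splitAt⁻¹-↑ˡ eqi) (splitAt⁻¹-↑ʳ eqj) (GH i′ j′)
... | inj₂ i′ | inj₁ j′ = subst₂ (λ s t → F s t ≡ 0ℤ) (splitAt⁻¹-↑ʳ eqi) (splitAt⁻¹-↑ˡ eqj) (HG i′ j′)
... | inj₂ i′ | inj₂ j′ = subst₂ (λ s t → F s t ≡ H i′ j′) (splitAt⁻¹-↑ʳ eqi) (splitAt⁻¹-↑ʳ eqj) (HH i′ j′)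

-- Unimodular changes of basis

record Aut (n : ℕ) : Set where
  field
    to      : ℤ^ n → ℤ^ n
    from    : ℤ^ n → ℤ^ n
    to-add  : IsAdditive to
    from∘to : ∀ x → from (to x) ≡ x
    to∘from : ∀ y → to (from y) ≡ y

  from-add : IsAdditive from
  from-add x y = begin
    from (x ⊞ y)                     ≡⟨ cong from (cong₂ _⊞_ (to∘from x) (to∘from y)) ⟨
    from (to (from x) ⊞ to (from y)) ≡⟨ cong from (to-add (from x) (from y)) ⟨
    from (to (from x ⊞ from y))      ≡⟨ from∘to (from x ⊞ from y) ⟩
    from x ⊞ from y                  ∎

open Aut

id-aut : ∀ {n} → Aut n
id-aut = record { to = λ x → x ; from = λ x → x ; to-add = λ _ _ → refl ; from∘to = λ _ → refl ; to∘from = λ _ → refl }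

infixr 9 _∘ᴬ_

_∘ᴬ_ : ∀ {n} → Aut n → Aut n → Aut n
S ∘ᴬ T = record
  { to      = to S ∘ to T
  ; from    = from T ∘ from S
  ; to-add  = λ x y → trans (cong (to S) (to-add T x y)) (to-add S _ _)
  ; from∘to = λ x → trans (cong (from T) (from∘to S (to T x))) (from∘to T x)
  ; to∘from = λ y → trans (cong (to S) (to∘from T (from S y))) (to∘from S y)
  }

scale-head : ∀ {n} (ε : ℤ) → ε * ε ≡ 1ℤ → Aut (suc n)
scale-head ε ε²≡1 = record { to = f ; from = f ; to-add = f-add ; from∘to = f∘f ; to∘from = f∘f }
  where
  f : ℤ^ _ → ℤ^ _
  f (x ∷ xs) = ε * x ∷ xs
  f-add : IsAdditive f
  f-add (x ∷ xs) (y ∷ ys) = cong (_∷ zipWith _+_ xs ys) (*-distribˡ-+ ε x y)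
  f∘f : ∀ x → f (f x) ≡ x
  f∘f (x ∷ xs) = cong (_∷ xs) (trans (sym (*-assoc ε ε x)) (trans (cong (_* x) ε²≡1) (*-identityˡ x)))

on-tail : ∀ {n} → Aut n → Aut (suc n)
on-tail T = record
  { to      = λ { (x ∷ xs) → x ∷ to T xs }
  ; from    = λ { (x ∷ xs) → x ∷ from T xs }
  ; to-add  = λ { (x ∷ xs) (y ∷ ys) → cong (x + y ∷_) (to-add T xs ys) }
  ; from∘to = λ { (x ∷ xs) → cong (x ∷_) (from∘to T xs) }
  ; to∘from = λ { (x ∷ xs) → cong (x ∷_) (to∘from T xs) }
  }

on-first-two : ∀ {n} → Aut 2 → Aut (2 ℕ.+ n)
on-first-two M = record
  { to      = lift (to M)
  ; from    = lift (from M)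
  ; to-add  = λ { (x ∷ y ∷ r) (x′ ∷ y′ ∷ s) →
      trans (cong (_++ zipWith _+_ r s) (to-add M (x ∷ y ∷ []) (x′ ∷ y′ ∷ [])))
            (sym (zipWith-++ _+_ (to M (x ∷ y ∷ [])) r (to M (x′ ∷ y′ ∷ [])) s)) }
  ; from∘to = lift-inverse (from M) (to M) (from∘to M)
  ; to∘from = lift-inverse (to M) (from M) (to∘from M)
  }
  where
  lift : (ℤ^ 2 → ℤ^ 2) → ℤ^ (2 ℕ.+ _) → ℤ^ (2 ℕ.+ _)
  lift f (x ∷ y ∷ r) = f (x ∷ y ∷ []) ++ r
  lift-++ : ∀ f (w : ℤ^ 2) (r : ℤ^ _) → lift f (w ++ r) ≡ f w ++ r
  lift-++ f (x ∷ y ∷ []) r = refl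
  lift-inverse : ∀ f g → (∀ w → f (g w) ≡ w) → ∀ v → lift f (lift g v) ≡ v
  lift-inverse f g fg (x ∷ y ∷ r) = trans (lift-++ f (g (x ∷ y ∷ [])) r) (cong (_++ r) (fg (x ∷ y ∷ [])))

euclid-step : ℤ → Aut 2
euclid-step q = record { to = f ; from = g ; to-add = f-add ; from∘to = g∘f ; to∘from = f∘g }
  where
  f g : ℤ^ 2 → ℤ^ 2
  f (w₀ ∷ w₁ ∷ []) = w₁ ∷ w₀ - q * w₁ ∷ []
  g (y₀ ∷ y₁ ∷ []) = y₁ + q * y₀ ∷ y₀ ∷ []
  f-add : IsAdditive f
  f-add (a ∷ b ∷ []) (c ∷ d ∷ []) = cong (λ z → b + d ∷ z ∷ []) (distrib q a b c d)
    where
    distrib : ∀ q a b c d → (a + c) - q * (b + d) ≡ (a - q * b) + (c - q * d)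
    distrib = solve-∀
  g∘f : ∀ w → g (f w) ≡ w
  g∘f (a ∷ b ∷ []) = cong (λ z → z ∷ b ∷ []) (cancel q a b)
    where
    cancel : ∀ q a b → (a - q * b) + q * b ≡ a
    cancel = solve-∀
  f∘g : ∀ w → f (g w) ≡ w
  f∘g (a ∷ b ∷ []) = cong (λ z → a ∷ z ∷ []) (cancel q a b)
    where
    cancel : ∀ q a b → (b + q * a) - q * a ≡ b
    cancel = solve-∀

RowReduction : ∀ {n} → ℤ^ (suc n) → Set
RowReduction {n} c = ∃[ g ] Σ (Aut (suc n)) λ T → ∀ x → c · to T x ≡ g * head x

row-reduction-step : ∀ a b q r → a ≡ r + q * b → RowReduction (b ∷ r ∷ []) → RowReduction (a ∷ b ∷ [])
row-reduction-step a b q r a≡r+qb (g , M , reduces) =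
  g , euclid-step q ∘ᴬ M , λ v → trans (step-preserves-row (to M v)) (reduces v)
  where
  step-preserves-row : ∀ w → (a ∷ b ∷ []) · to (euclid-step q) w ≡ (b ∷ r ∷ []) · w
  step-preserves-row (w₀ ∷ w₁ ∷ []) rewrite a≡r+qb = expand r q b w₀ w₁
    where
    expand : ∀ r q b w₀ w₁ → (r + q * b) * w₁ + (b * (w₀ - q * w₁) + 0ℤ) ≡ b * w₀ + (r * w₁ + 0ℤ)
    expand = solve-∀

euclid : ∀ (bound : ℕ) a b → ∣ b ∣ ℕ.< bound → RowReduction (a ∷ b ∷ [])
euclid (suc bound) a b (ℕ.s≤s |b|≤bound) with b ℤ.≟ 0ℤ
... | yes refl = a , id-aut , λ { (x ∷ y ∷ []) → row-a0 a x y }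
  where
  row-a0 : ∀ a x y → a * x + (0ℤ * y + 0ℤ) ≡ a * x
  row-a0 = solve-∀
... | no b≢0 = row-reduction-step a b (a / b) (+ (a % b)) (a≡a%n+[a/n]*n a b)
                 (euclid bound b (+ (a % b)) (ℕ.<-≤-trans (n%d<d a b) |b|≤bound))
  where
  instance
    b-nonZero : ℤ.NonZero b
    b-nonZero = ℤ.≢-nonZero b≢0

row-reduce : ∀ {n} (c : ℤ^ (suc n)) → RowReduction c
row-reduce (a ∷ []) = a , id-aut , λ { (x ∷ []) → +-identityʳ (a * x) }
row-reduce (a ∷ c@(_ ∷ _)) with row-reduce c
... | g′ , T′ , reduces′ with euclid (suc ∣ g′ ∣) a g′ ℕ.≤-refl
... | g , M , reduces = g , on-tail T′ ∘ᴬ on-first-two M , λ { (x₀ ∷ x₁ ∷ xs) →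
        trans (through-tail (to M (x₀ ∷ x₁ ∷ [])) xs) (reduces (x₀ ∷ x₁ ∷ [])) }
  where
  through-tail : ∀ (w : ℤ^ 2) xs → (a ∷ c) · to (on-tail T′) (w ++ xs) ≡ (a ∷ g′ ∷ []) · w
  through-tail (w₀ ∷ w₁ ∷ []) xs = cong (_+_ (a * w₀)) (trans (reduces′ (w₁ ∷ xs)) (sym (+-identityʳ (g′ * w₁))))

unit-square : ∀ a b → a * b ≡ 1ℤ → a * a ≡ 1ℤ
unit-square a b ab≡1 with ℕ.m*n≡1⇒m≡1 ∣ a ∣ ∣ b ∣ (trans (sym (abs-* a b)) (cong ∣_∣ ab≡1))
unit-square (+ .1)     b _ | refl = refl
unit-square -[1+ .0 ] b _ | refl = refl

unimodular-row⇒coordinate : ∀ {n} (c u : ℤ^ (suc n)) → c · u ≡ 1ℤ →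
  Σ (Aut (suc n)) λ T → ∀ x → c · to T x ≡ head x
unimodular-row⇒coordinate c u c·u≡1 with row-reduce c
... | g , T , reduces = T ∘ᴬ scale-head g g²≡1 , λ { (x ∷ xs) →
        trans (reduces (g * x ∷ xs)) (trans (sym (*-assoc g g x)) (trans (cong (_* x) g²≡1) (*-identityˡ x))) }
  where
  g²≡1 : g * g ≡ 1ℤ
  g²≡1 = unit-square g (head (from T u)) (trans (sym (reduces (from T u))) (trans (cong (c ·_) (to∘from T u)) c·u≡1))

record FreeKernel {r n} (φ : Fin r → ℤ^ n → ℤ) : Set where
  field
    rank          : ℕ
    embed         : ℤ^ rank → ℤ^ n
    retract       : ℤ^ n → ℤ^ rank
    embed-add     : IsAdditive embed
    retract-add   : IsAdditive retract
    φ∘embed       : ∀ i w → φ i (embed w) ≡ 0ℤ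
    retract∘embed : ∀ w → retract (embed w) ≡ w
    embed∘retract : ∀ y → (∀ i → φ i y ≡ 0ℤ) → embed (retract y) ≡ y

-- After a change of basis φ becomes the first coordinate, whose kernel is spanned by the others.
kernel-of-functional : ∀ {n} (φ : ℤ^ n → ℤ) → IsAdditiveFunctional φ → ∀ u → φ u ≡ 1ℤ →
  FreeKernel {1} (λ _ → φ)
kernel-of-functional {zero} φ add [] φ[]≡1 = ⊥-elim (0≢1 (trans (sym (idempotent⇒0 (φ []) (sym (add [] [])))) φ[]≡1))
  where
  0≢1 : 0ℤ ≢ 1ℤ
  0≢1 ()
kernel-of-functional {suc n} φ add u φu≡1 = record
  { rank          = n
  ; embed         = h
  ; retract       = h⁻
  ; embed-add     = λ x y → to-add T (0ℤ ∷ x) (0ℤ ∷ y)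
  ; retract-add   = λ x y → trans (cong tail (from-add T x y)) (tail-⊞ (from T x) (from T y))
  ; φ∘embed       = λ _ w → φ∘T (0ℤ ∷ w)
  ; retract∘embed = λ w → cong tail (from∘to T (0ℤ ∷ w))
  ; embed∘retract = λ y φy≡0 → trans (cong (to T) (head≡0 (from T y) (head-from≡0 y (φy≡0 zero)))) (to∘from T y)
  }
  where
  c : ℤ^ (suc n)
  c = tabulate (φ ∘ e)
  coordinate : Σ (Aut (suc n)) λ T → ∀ x → c · to T x ≡ head x
  coordinate = unimodular-row⇒coordinate c u (trans (sym (additive⇒dot φ add u)) φu≡1)
  T : Aut (suc n)
  T = proj₁ coordinate
  φ∘T : ∀ x → φ (to T x) ≡ head x
  φ∘T x = trans (additive⇒dot φ add (to T x)) (proj₂ coordinate x)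
  h : ℤ^ n → ℤ^ (suc n)
  h w = to T (0ℤ ∷ w)
  h⁻ : ℤ^ (suc n) → ℤ^ n
  h⁻ y = tail (from T y)
  tail-⊞ : ∀ (a b : ℤ^ (suc n)) → tail (a ⊞ b) ≡ tail a ⊞ tail b
  tail-⊞ (_ ∷ _) (_ ∷ _) = refl
  head≡0 : ∀ (v : ℤ^ (suc n)) → head v ≡ 0ℤ → 0ℤ ∷ tail v ≡ v
  head≡0 (x ∷ xs) refl = refl
  head-from≡0 : ∀ y → φ y ≡ 0ℤ → head (from T y) ≡ 0ℤ
  head-from≡0 y φy≡0 = trans (sym (φ∘T (from T y))) (trans (cong φ (to∘from T y)) φy≡0)

free-kernel : ∀ {r n} (φ : Fin r → ℤ^ n → ℤ) → (∀ i → IsAdditiveFunctional (φ i)) →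
  (u : Fin r → ℤ^ n) → (∀ i j → φ i (u j) ≡ δ i j) → FreeKernel φ
free-kernel {zero} {n} φ _ _ _ = record
  { rank = n ; embed = λ x → x ; retract = λ x → x ; embed-add = λ _ _ → refl ; retract-add = λ _ _ → refl
  ; φ∘embed = λ () ; retract∘embed = λ _ → refl ; embed∘retract = λ _ _ → refl }
free-kernel {suc r} φ add u dual = record
  { rank          = rank K
  ; embed         = embed K₀ ∘ embed K
  ; retract       = retract K ∘ retract K₀
  ; embed-add     = λ x y → trans (cong (embed K₀) (embed-add K x y)) (embed-add K₀ _ _)
  ; retract-add   = λ x y → trans (cong (retract K) (retract-add K₀ x y)) (retract-add K _ _)
  ; φ∘embed       = λ { zero w → φ∘embed K₀ zero (embed K w) ; (suc i) w → φ∘embed K i w }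
  ; retract∘embed = λ w → trans (cong (retract K) (retract∘embed K₀ (embed K w))) (retract∘embed K w)
  ; embed∘retract = λ y φy≡0 → trans (cong (embed K₀) (embed∘retract K (retract K₀ y) λ i →
                      trans (cong (φ (suc i)) (into-K₀ y (φy≡0 zero))) (φy≡0 (suc i)))) (into-K₀ y (φy≡0 zero))
  }
  where
  open FreeKernel
  K₀ : FreeKernel {1} (λ _ → φ zero)
  K₀ = kernel-of-functional (φ zero) (add zero) (u zero) (dual zero zero)
  into-K₀ : ∀ y → φ zero y ≡ 0ℤ → embed K₀ (retract K₀ y) ≡ y
  into-K₀ y φ₀y≡0 = embed∘retract K₀ y (λ _ → φ₀y≡0)
  K : FreeKernel (λ i → φ (suc i) ∘ embed K₀)
  K = free-kernel (λ i → φ (suc i) ∘ embed K₀)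
        (λ i x y → trans (cong (φ (suc i)) (embed-add K₀ x y)) (add (suc i) _ _))
        (λ j → retract K₀ (u (suc j)))
        (λ i j → trans (cong (φ (suc i)) (into-K₀ (u (suc j)) (dual zero (suc j)))) (dual (suc i) (suc j)))

-- Splitting off a unimodular sublattice

record IntegralInverse {r} (H : Gram r) : Set where
  field
    inverse       : Gram r
    inverse-left  : ∀ i j → ∑[ l < r ] (inverse i l * H l j) ≡ δ i j
    inverse-right : ∀ i j → ∑[ l < r ] (H i l * inverse l j) ≡ δ i j

-- φ i x are the coordinates of the orthogonal projection of x onto the span of v.
module UnimodularSplitting {n r} (G : Gram n) (G-lattice : IsIntegralLattice G)
  (H : Gram r) (H⁻¹ : IntegralInverse H) (v : Fin r → ℤ^ n) (v-gram : ∀ i j → B G (v i) (v j) ≡ H i j) where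

  open IntegralInverse H⁻¹

  H-sym : ∀ i j → H i j ≡ H j i
  H-sym i j = trans (sym (v-gram i j)) (trans (B-sym G (proj₁ G-lattice) (v i) (v j)) (v-gram j i))

  ψ : Fin r → ℤ^ n → ℤ
  ψ j x = B G x (v j)

  φ : Fin r → ℤ^ n → ℤ
  φ i x = ∑[ j < r ] (inverse i j * ψ j x)

  φ-add : ∀ i → IsAdditiveFunctional (φ i)
  φ-add i x y = ∑-cong-+ λ j → trans (cong (inverse i j *_) (B-⊞ˡ G x y (v j))) (*-distribˡ-+ (inverse i j) _ _)

  φ-dual : ∀ i l → φ i (v l) ≡ δ i l
  φ-dual i l = trans (sum-cong-≗ λ j → cong (inverse i j *_) (trans (v-gram l j) (H-sym l j))) (inverse-left i l)

  ψ-via-φ : ∀ j x → ψ j x ≡ ∑[ i < r ] (H j i * φ i x)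
  ψ-via-φ j x = sym (begin
    ∑[ i < r ] (H j i * φ i x)                             ≡⟨ sum-cong-≗ (λ i → *-distribˡ-sum (H j i) (λ k → inverse i k * ψ k x)) ⟩
    ∑[ i < r ] ∑[ k < r ] (H j i * (inverse i k * ψ k x))  ≡⟨ ∑-comm (λ i k → H j i * (inverse i k * ψ k x)) ⟩
    ∑[ k < r ] ∑[ i < r ] (H j i * (inverse i k * ψ k x))  ≡⟨ sum-cong-≗ (λ k → trans (sum-cong-≗ λ i → sym (*-assoc (H j i) _ _))
                                                                (sym (*-distribʳ-sum (ψ k x) (λ i → H j i * inverse i k)))) ⟩
    ∑[ k < r ] (∑[ i < r ] (H j i * inverse i k) * ψ k x)  ≡⟨ sum-cong-≗ (λ k → cong (_* ψ k x) (inverse-right j k)) ⟩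
    ∑[ k < r ] (δ j k * ψ k x)                             ≡⟨ ∑-δ j (λ k → ψ k x) ⟩
    ψ j x                                                  ∎)

  V : ℤ^ r → ℤ^ n
  V = lincomb v

  P : ℤ^ n → ℤ^ r
  P x = tabulate λ i → φ i x

  φ∘V : ∀ i a → φ i (V a) ≡ lookup a i
  φ∘V i a = begin
    φ i (V a)                          ≡⟨ functional-lincomb (φ i) (φ-add i) v a ⟩
    ∑[ l < r ] (lookup a l * φ i (v l)) ≡⟨ sum-cong-≗ (λ l → trans (cong (lookup a l *_) (φ-dual i l)) (*-comm (lookup a l) (δ i l))) ⟩
    ∑[ l < r ] (δ i l * lookup a l)     ≡⟨ ∑-δ i (lookup a) ⟩
    lookup a i                         ∎

  P-add : IsAdditive P
  P-add x y = lookup-ext λ i → begin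
    lookup (P (x ⊞ y)) i         ≡⟨ lookup∘tabulate _ i ⟩
    φ i (x ⊞ y)                  ≡⟨ φ-add i x y ⟩
    φ i x + φ i y                ≡⟨ cong₂ _+_ (lookup∘tabulate _ i) (lookup∘tabulate _ i) ⟨
    lookup (P x) i + lookup (P y) i ≡⟨ lookup-⊞ (P x) (P y) i ⟨
    lookup (P x ⊞ P y) i         ∎

  K : FreeKernel φ
  K = free-kernel φ φ-add v φ-dual

  open FreeKernel K

  π : ℤ^ n → ℤ^ n
  π x = x ⊟ V (P x)

  φ∘π : ∀ i x → φ i (π x) ≡ 0ℤ
  φ∘π i x = begin
    φ i (x ⊟ V (P x))          ≡⟨ functional-⊟ (φ i) (φ-add i) x (V (P x)) ⟩
    φ i x - φ i (V (P x))      ≡⟨ cong (_-_ (φ i x)) (trans (φ∘V i (P x)) (lookup∘tabulate _ i)) ⟩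
    φ i x - φ i x              ≡⟨ +-inverseʳ (φ i x) ⟩
    0ℤ                         ∎

  π-add : IsAdditive π
  π-add x y = begin
    (x ⊞ y) ⊟ V (P (x ⊞ y))           ≡⟨ cong (λ z → (x ⊞ y) ⊟ V z) (P-add x y) ⟩
    (x ⊞ y) ⊟ V (P x ⊞ P y)           ≡⟨ cong ((x ⊞ y) ⊟_) (lincomb-add v (P x) (P y)) ⟩
    (x ⊞ y) ⊟ (V (P x) ⊞ V (P y))     ≡⟨ ⊞-⊟-interchange x y (V (P x)) (V (P y)) ⟩
    π x ⊞ π y                         ∎

  orthogonal : ∀ i w → B G (v i) (embed w) ≡ 0ℤ
  orthogonal i w = begin
    B G (v i) (embed w)                  ≡⟨ B-sym G (proj₁ G-lattice) (v i) (embed w) ⟩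
    ψ i (embed w)                        ≡⟨ ψ-via-φ i (embed w) ⟩
    ∑[ k < r ] (H i k * φ k (embed w))   ≡⟨ ∑-zero (λ k → trans (cong (H i k *_) (φ∘embed k w)) (*-zeroʳ (H i k))) ⟩
    0ℤ                                   ∎

  decompose : ℤ^ n → ℤ^ (r ℕ.+ rank)
  decompose x = P x ++ retract (π x)

  compose : ℤ^ (r ℕ.+ rank) → ℤ^ n
  compose w = V (take r w) ⊞ embed (drop r w)

  compose-++ : ∀ a q → compose (a ++ q) ≡ V a ⊞ embed q
  compose-++ a q = cong₂ (λ s t → V s ⊞ embed t) (proj₁ (take-drop-++ a q)) (proj₂ (take-drop-++ a q))

  compose∘decompose : ∀ x → compose (decompose x) ≡ x
  compose∘decompose x = begin
    compose (P x ++ retract (π x))      ≡⟨ compose-++ (P x) (retract (π x)) ⟩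
    V (P x) ⊞ embed (retract (π x))     ≡⟨ cong (V (P x) ⊞_) (embed∘retract (π x) (λ i → φ∘π i x)) ⟩
    V (P x) ⊞ (x ⊟ V (P x))             ≡⟨ ⊞-⊟-cancelʳ x (V (P x)) ⟩
    x                                   ∎

  decompose∘compose : ∀ w → decompose (compose w) ≡ w
  decompose∘compose w = begin
    P y ++ retract (π y)                ≡⟨ cong₂ _++_ P-y (trans (cong retract π-y) (retract∘embed q)) ⟩
    a ++ q                              ≡⟨ take++drop≡id r w ⟩
    w                                   ∎
    where
    a : ℤ^ r
    a = take r w
    q : ℤ^ rank
    q = drop r w
    y : ℤ^ n
    y = V a ⊞ embed q
    P-y : P y ≡ a
    P-y = lookup-ext λ i → begin
      lookup (P y) i               ≡⟨ lookup∘tabulate _ i ⟩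
      φ i (V a ⊞ embed q)          ≡⟨ φ-add i (V a) (embed q) ⟩
      φ i (V a) + φ i (embed q)    ≡⟨ cong₂ _+_ (φ∘V i a) (φ∘embed i q) ⟩
      lookup a i + 0ℤ              ≡⟨ +-identityʳ _ ⟩
      lookup a i                   ∎
    π-y : π y ≡ embed q
    π-y = trans (cong (λ z → y ⊟ V z) P-y) (⊞-⊟-cancelˡ (V a) (embed q))

  decompose-add : IsAdditive decompose
  decompose-add x y = begin
    P (x ⊞ y) ++ retract (π (x ⊞ y))                ≡⟨ cong₂ _++_ (P-add x y) (trans (cong retract (π-add x y)) (retract-add (π x) (π y))) ⟩
    (P x ⊞ P y) ++ (retract (π x) ⊞ retract (π y))  ≡⟨ zipWith-++ _+_ (P x) (retract (π x)) (P y) (retract (π y)) ⟨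
    decompose x ⊞ decompose y                       ∎

  compose-add : IsAdditive compose
  compose-add w z = begin
    V (take r (w ⊞ z)) ⊞ embed (drop r (w ⊞ z))                         ≡⟨ cong₂ (λ s t → V s ⊞ embed t) (take-zipWith _+_ w z) (drop-zipWith _+_ w z) ⟩
    V (take r w ⊞ take r z) ⊞ embed (drop r w ⊞ drop r z)               ≡⟨ cong₂ _⊞_ (lincomb-add v (take r w) (take r z)) (embed-add (drop r w) (drop r z)) ⟩
    (V (take r w) ⊞ V (take r z)) ⊞ (embed (drop r w) ⊞ embed (drop r z)) ≡⟨ ⊞-interchange _ _ _ _ ⟩
    compose w ⊞ compose z                                               ∎

  N : Gram rank
  N = pullback G embed

  N-lattice : IsIntegralLattice N
  N-lattice = pullback-isIntegralLattice G embed G-lattice embed-add λ w embed-w≡0 → begin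
    w                  ≡⟨ retract∘embed w ⟨
    retract (embed w)  ≡⟨ cong retract embed-w≡0 ⟩
    retract 0ᵥ         ≡⟨ additive⇒0 retract retract-add ⟩
    0ᵥ                 ∎

  compose-e-left : ∀ i → compose (e (i ↑ˡ rank)) ≡ v i
  compose-e-left i = begin
    compose (e (i ↑ˡ rank))   ≡⟨ cong compose (e-↑ˡ rank i) ⟩
    compose (e i ++ 0ᵥ)       ≡⟨ compose-++ (e i) 0ᵥ ⟩
    V (e i) ⊞ embed 0ᵥ        ≡⟨ cong₂ _⊞_ (lincomb-e v i) (additive⇒0 embed embed-add) ⟩
    v i ⊞ 0ᵥ                  ≡⟨ ⊞-identityʳ (v i) ⟩
    v i                       ∎

  compose-e-right : ∀ j → compose (e (r ↑ʳ j)) ≡ embed (e j)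
  compose-e-right j = begin
    compose (e (r ↑ʳ j))      ≡⟨ cong compose (e-↑ʳ r j) ⟩
    compose (0ᵥ ++ e j)       ≡⟨ compose-++ 0ᵥ (e j) ⟩
    V 0ᵥ ⊞ embed (e j)        ≡⟨ cong (_⊞ embed (e j)) (additive⇒0 V (lincomb-add v)) ⟩
    0ᵥ ⊞ embed (e j)          ≡⟨ ⊞-identityˡ (embed (e j)) ⟩
    embed (e j)               ∎

  isometric : Isometric G (H ⊥ᴳ N)
  isometric = isometric-by-basis G (H ⊥ᴳ N) decompose compose decompose-add compose-add compose∘decompose decompose∘compose
    (⊥ᴳ-blocks H N (pullback G compose)
      (λ i j → trans (cong₂ (B G) (compose-e-left i) (compose-e-left j)) (v-gram i j))
      (λ i j → trans (cong₂ (B G) (compose-e-left i) (compose-e-right j)) (orthogonal i (e j)))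
      (λ i j → trans (cong₂ (B G) (compose-e-right i) (compose-e-left j))
                     (trans (B-sym G (proj₁ G-lattice) (embed (e i)) (v j)) (orthogonal j (e i))))
      (λ i j → cong₂ (B G) (compose-e-right i) (compose-e-right j)))

split-unimodular : ∀ {n r} (G : Gram n) → IsIntegralLattice G → (H : Gram r) → IntegralInverse H →
  (v : Fin r → ℤ^ n) → (∀ i j → B G (v i) (v j) ≡ H i j) →
  ∃[ m ] Σ (Gram m) λ N → IsIntegralLattice N × Isometric G (H ⊥ᴳ N)
split-unimodular G G-lattice H H⁻¹ v v-gram = rank , N , N-lattice , isometric
  where
  open UnimodularSplitting G G-lattice H H⁻¹ v v-gram
  open FreeKernel K using (rank)

-- A8 and the glue vector γ

prime∣square⇒prime∣ : ∀ {p} → Prime p → ∀ T → + p ∣ T * T → + p ∣ T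
prime∣square⇒prime∣ {p} p-prime T p∣T² with euclidsLemma ∣ T ∣ ∣ T ∣ p-prime (subst (p ℕ.∣_) (abs-* T T) (∣⇒∣ᵤ p∣T²))
... | inj₁ p∣T = ∣ᵤ⇒∣ p∣T
... | inj₂ p∣T = ∣ᵤ⇒∣ p∣T

three-divides-or-unit-residue : ∀ T′ → (∃[ q ] T′ ≡ q * + 3) ⊎ (∃[ ε ] ∃[ s ] ε * (+ 3 * s - T′) ≡ 1ℤ)
three-divides-or-unit-residue T′ with T′ % + 3 | n%d<d T′ (+ 3) | a≡a%n+[a/n]*n T′ (+ 3)
... | 0 | _ | T′≡ = inj₁ (T′ / + 3 , trans T′≡ (+-identityˡ _))
... | 1 | _ | T′≡ = inj₂ (-1ℤ , T′ / + 3 , trans (cong (λ w → -1ℤ * (+ 3 * (T′ / + 3) - w)) T′≡) (residue₁ (T′ / + 3)))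
  where
  residue₁ : ∀ q → -1ℤ * (+ 3 * q - (+ 1 + q * + 3)) ≡ 1ℤ
  residue₁ = solve-∀
... | 2 | _ | T′≡ = inj₂ (1ℤ , T′ / + 3 + 1ℤ , trans (cong (λ w → 1ℤ * (+ 3 * (T′ / + 3 + 1ℤ) - w)) T′≡) (residue₂ (T′ / + 3)))
  where
  residue₂ : ∀ q → 1ℤ * (+ 3 * (q + 1ℤ) - (+ 2 + q * + 3)) ≡ 1ℤ
  residue₂ = solve-∀
... | suc (suc (suc _)) | ℕ.s≤s (ℕ.s≤s (ℕ.s≤s ())) | _

infixl 6 _+ᴬ_
infixr 7 _*ᴬ_

_+ᴬ_ : A8 → A8 → A8
(a , Σa≡0) +ᴬ (b , Σb≡0) = a ⊞ b , trans (Σℤ-⊞ a b) (cong₂ _+_ Σa≡0 Σb≡0)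

_*ᴬ_ : ℤ → A8 → A8
k *ᴬ (a , Σa≡0) = k ·ᵥ a , trans (Σℤ-·ᵥ k a) (trans (cong (k *_) Σa≡0) (*-zeroʳ k))

sum-zero-quotient : ∀ k c (a b : A8) (f : ℤ^ 9) → k ≢ 0ℤ →
  proj₁ a ≡ (c ·ᵥ proj₁ b) ⊞ (k ·ᵥ f) → Σℤ f ≡ 0ℤ
sum-zero-quotient k c (a , Σa≡0) (b , Σb≡0) f k≢0 a≡cb+kf =
  *-cancelˡ-≡ k (Σℤ f) 0ℤ {{ℤ.≢-nonZero k≢0}} (begin
    k * Σℤ f                          ≡⟨ +-identityˡ _ ⟨
    0ℤ + k * Σℤ f                     ≡⟨ cong₂ _+_ (trans (cong (c *_) Σb≡0) (*-zeroʳ c)) (Σℤ-·ᵥ k f) ⟨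
    c * Σℤ b + Σℤ (k ·ᵥ f)            ≡⟨ cong (_+ Σℤ (k ·ᵥ f)) (Σℤ-·ᵥ c b) ⟨
    Σℤ (c ·ᵥ b) + Σℤ (k ·ᵥ f)         ≡⟨ Σℤ-⊞ (c ·ᵥ b) (k ·ᵥ f) ⟨
    Σℤ ((c ·ᵥ b) ⊞ (k ·ᵥ f))          ≡⟨ cong Σℤ a≡cb+kf ⟨
    Σℤ a                              ≡⟨ Σa≡0 ⟩
    0ℤ                                ≡⟨ *-zeroʳ k ⟨
    k * 0ℤ                            ∎)

module A8Representation {n} (G : Gram n) (G-sym : IsSymmetric G) (σ : A8 → ℤ^ n) (σ-rep : IsRepA8 G σ) where

  σ-cong : ∀ {a b : A8} → proj₁ a ≡ proj₁ b → σ a ≡ σ b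
  σ-cong {a , p} {.a , q} refl = cong (λ r → σ (a , r)) (≡-irrelevant p q)
    where open Decidable⇒UIP ℤ._≟_ using (≡-irrelevant)

  σ-+ : ∀ a b → σ (a +ᴬ b) ≡ σ a ⊞ σ b
  σ-+ a b = proj₁ σ-rep a b (a +ᴬ b) refl

  σ-* : ∀ k a → σ (k *ᴬ a) ≡ k ·ᵥ σ a
  σ-* k a = lookup-ext λ p → begin
    lookup (σ (k *ᴬ a)) p          ≡⟨ ℤ-additive⇒linear (λ l → lookup (σ (l *ᴬ a)) p) (hom p) k ⟩
    k * lookup (σ (1ℤ *ᴬ a)) p     ≡⟨ cong (λ y → k * lookup y p) (σ-cong (·ᵥ-identity (proj₁ a))) ⟩
    k * lookup (σ a) p             ≡⟨ lookup-·ᵥ k (σ a) p ⟨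
    lookup (k ·ᵥ σ a) p            ∎
    where
    hom : ∀ p l m → lookup (σ ((l + m) *ᴬ a)) p ≡ lookup (σ (l *ᴬ a)) p + lookup (σ (m *ᴬ a)) p
    hom p l m = trans (cong (λ y → lookup y p) (trans (σ-cong (·ᵥ-distribʳ l m (proj₁ a))) (σ-+ (l *ᴬ a) (m *ᴬ a))))
                      (lookup-⊞ (σ (l *ᴬ a)) (σ (m *ᴬ a)) p)

  σ-B : ∀ a b → B G (σ a) (σ b) ≡ proj₁ a · proj₁ b
  σ-B a@(a⃗ , _) b@(b⃗ , _) = *-cancelˡ-≡ (+ 2) _ _ (∙-cancelˡ (a⃗ · a⃗) _ _ (∙-cancelʳ (b⃗ · b⃗) _ _ (begin
    a⃗ · a⃗ + + 2 * B G (σ a) (σ b) + b⃗ · b⃗               ≡⟨ cong₂ (λ p q → p + + 2 * B G (σ a) (σ b) + q) (proj₂ σ-rep a) (proj₂ σ-rep b) ⟨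
    Q G (σ a) + + 2 * B G (σ a) (σ b) + Q G (σ b)       ≡⟨ Q-⊞ G G-sym (σ a) (σ b) ⟨
    Q G (σ a ⊞ σ b)                                     ≡⟨ cong (Q G) (σ-+ a b) ⟨
    Q G (σ (a +ᴬ b))                                    ≡⟨ proj₂ σ-rep (a +ᴬ b) ⟩
    (a⃗ ⊞ b⃗) · (a⃗ ⊞ b⃗)                                   ≡⟨ ·-⊞-square a⃗ b⃗ ⟩
    a⃗ · a⃗ + + 2 * (a⃗ · b⃗) + b⃗ · b⃗                       ∎)))

  scaled-B : ∀ k {y y′} a b → k ·ᵥ y ≡ σ a → k ·ᵥ y′ ≡ σ b → k * k * B G y y′ ≡ proj₁ a · proj₁ b
  scaled-B k {y} {y′} a b ky≡σa ky′≡σb = begin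
    k * k * B G y y′           ≡⟨ *-assoc k k _ ⟩
    k * (k * B G y y′)         ≡⟨ cong (k *_) (B-·ʳ G k y y′) ⟨
    k * B G y (k ·ᵥ y′)        ≡⟨ B-·ˡ G k y (k ·ᵥ y′) ⟨
    B G (k ·ᵥ y) (k ·ᵥ y′)     ≡⟨ cong₂ (B G) ky≡σa ky′≡σb ⟩
    B G (σ a) (σ b)            ≡⟨ σ-B a b ⟩
    proj₁ a · proj₁ b          ∎

γ-offset : ℤ^ 9
γ-offset = 0ℤ ∷ 0ℤ ∷ 0ℤ ∷ 0ℤ ∷ 0ℤ ∷ 0ℤ ∷ 1ℤ ∷ 1ℤ ∷ 1ℤ ∷ []

γ : A8
γ = (1ℤ ∷ 1ℤ ∷ 1ℤ ∷ 1ℤ ∷ 1ℤ ∷ 1ℤ ∷ -[1+ 1 ] ∷ -[1+ 1 ] ∷ -[1+ 1 ] ∷ []) , refl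

lookup-γ : ∀ i → lookup (proj₁ γ) i ≡ 1ℤ - + 3 * lookup γ-offset i
lookup-γ i = trans (cong (λ w → lookup w i) γ≡) (lookup-map i (λ g → 1ℤ - + 3 * g) γ-offset)
  where
  γ≡ : proj₁ γ ≡ map (λ g → 1ℤ - + 3 * g) γ-offset
  γ≡ = refl

module Saturation {n} (G : Gram n) (G-sym : IsSymmetric G) (σ : A8 → ℤ^ n) (σ-rep : IsRepA8 G σ)
  (x : ℤ^ n) (k : ℤ) (k≢0 : k ≢ 0ℤ) (a : A8) (σa≡kx : σ a ≡ k ·ᵥ x) where

  open A8Representation G G-sym σ σ-rep

  ω : Fin 9
  ω = fromℕ 8

  β : Fin 9 → A8
  β i = e i ⊟ e ω , trans (Σℤ-⊟ (e i) (e ω)) (cong₂ _-_ (Σℤ-e i) (Σℤ-e ω))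

  t : ℤ^ 9
  t = tabulate λ i → B G x (σ (β i))

  T : ℤ
  T = Σℤ t

  a₈ : ℤ
  a₈ = lookup (proj₁ a) ω

  k*tᵢ≡aᵢ-a₈ : ∀ i → k * lookup t i ≡ 1ℤ * lookup (proj₁ a) i - a₈
  k*tᵢ≡aᵢ-a₈ i = begin
    k * lookup t i                              ≡⟨ cong (k *_) (lookup∘tabulate (λ j → B G x (σ (β j))) i) ⟩
    k * B G x (σ (β i))                         ≡⟨ B-·ˡ G k x (σ (β i)) ⟨
    B G (k ·ᵥ x) (σ (β i))                      ≡⟨ cong (λ y → B G y (σ (β i))) σa≡kx ⟨
    B G (σ a) (σ (β i))                         ≡⟨ σ-B a (β i) ⟩
    proj₁ a · (e i ⊟ e ω)                       ≡⟨ ·-⊟ʳ (proj₁ a) (e i) (e ω) ⟩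
    proj₁ a · e i - proj₁ a · e ω               ≡⟨ cong₂ _-_ (trans (·-e (proj₁ a) i) (sym (*-identityˡ _))) (·-e (proj₁ a) ω) ⟩
    1ℤ * lookup (proj₁ a) i - a₈                ∎

  k*t≡a-a₈ : k ·ᵥ t ≡ affine 1ℤ a₈ (proj₁ a)
  k*t≡a-a₈ = lookup-ext λ i → trans (lookup-·ᵥ k t i) (trans (k*tᵢ≡aᵢ-a₈ i) (sym (lookup-affine 1ℤ a₈ (proj₁ a) i)))

  k*T≡-9a₈ : k * T ≡ - (+ 9 * a₈)
  k*T≡-9a₈ = begin
    k * T                             ≡⟨ Σℤ-·ᵥ k t ⟨
    Σℤ (k ·ᵥ t)                       ≡⟨ cong Σℤ k*t≡a-a₈ ⟩
    Σℤ (affine 1ℤ a₈ (proj₁ a))       ≡⟨ Σℤ-affine 1ℤ a₈ (proj₁ a) ⟩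
    1ℤ * Σℤ (proj₁ a) - + 9 * a₈      ≡⟨ cong (λ s → 1ℤ * s - + 9 * a₈) (proj₂ a) ⟩
    1ℤ * 0ℤ - + 9 * a₈                ≡⟨ +-identityˡ _ ⟩
    - (+ 9 * a₈)                      ∎

  u : A8
  u = affine (+ 9) T t , trans (Σℤ-affine (+ 9) T t) (+-inverseʳ (+ 9 * T))

  -- 9 annihilates the discriminant group of A8.
  σu≡9x : σ u ≡ (+ 9) ·ᵥ x
  σu≡9x = ·ᵥ-cancel k k≢0 _ _ (begin
    k ·ᵥ σ u                 ≡⟨ σ-* k u ⟨
    σ (k *ᴬ u)               ≡⟨ σ-cong (lookup-ext k*u≡9a) ⟩
    σ ((+ 9) *ᴬ a)             ≡⟨ σ-* (+ 9) a ⟩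
    (+ 9) ·ᵥ σ a               ≡⟨ cong ((+ 9) ·ᵥ_) σa≡kx ⟩
    (+ 9) ·ᵥ (k ·ᵥ x)          ≡⟨ ·ᵥ-comm (+ 9) k x ⟩
    k ·ᵥ ((+ 9) ·ᵥ x)          ∎)
    where
    k*u≡9a : ∀ i → lookup (k ·ᵥ affine (+ 9) T t) i ≡ lookup ((+ 9) ·ᵥ proj₁ a) i
    k*u≡9a i = begin
      lookup (k ·ᵥ affine (+ 9) T t) i            ≡⟨ trans (lookup-·ᵥ k (affine (+ 9) T t) i) (cong (k *_) (lookup-affine (+ 9) T t i)) ⟩
      k * (+ 9 * lookup t i - T)                 ≡⟨ distrib k (lookup t i) T ⟩
      + 9 * (k * lookup t i) - k * T             ≡⟨ cong₂ (λ p q → + 9 * p - q) (k*tᵢ≡aᵢ-a₈ i) k*T≡-9a₈ ⟩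
      + 9 * (1ℤ * lookup (proj₁ a) i - a₈) - - (+ 9 * a₈) ≡⟨ cancel (lookup (proj₁ a) i) a₈ ⟩
      + 9 * lookup (proj₁ a) i                   ≡⟨ lookup-·ᵥ (+ 9) (proj₁ a) i ⟨
      lookup ((+ 9) ·ᵥ proj₁ a) i                  ∎
      where
      distrib : ∀ k s T → k * (+ 9 * s - T) ≡ + 9 * (k * s) - k * T
      distrib = solve-∀
      cancel : ∀ a a₈ → + 9 * (1ℤ * a - a₈) - - (+ 9 * a₈) ≡ + 9 * a
      cancel = solve-∀

  T²≡9[t·t-Qx] : T * T ≡ + 9 * (t · t - Q G x)
  T²≡9[t·t-Qx] = *-cancelˡ-≡ (+ 9) _ _ (begin
    + 9 * (T * T)                                                  ≡⟨ isolate (t · t) T ⟩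
    + 9 * + 9 * (t · t) - (+ 9 * + 9 * (t · t) - + 2 * + 9 * T * T + + 9 * (T * T))
                                                                   ≡⟨ cong (_-_ (+ 9 * + 9 * (t · t))) (·-affine (+ 9) T t) ⟨
    + 9 * + 9 * (t · t) - proj₁ u · proj₁ u                        ≡⟨ cong (_-_ (+ 9 * + 9 * (t · t))) (scaled-B (+ 9) u u (sym σu≡9x) (sym σu≡9x)) ⟨
    + 9 * + 9 * (t · t) - + 9 * + 9 * Q G x                        ≡⟨ factor (t · t) (Q G x) ⟩
    + 9 * (+ 9 * (t · t - Q G x))                                  ∎)
    where
    isolate : ∀ s T → + 9 * (T * T) ≡ + 9 * + 9 * s - (+ 9 * + 9 * s - + 2 * + 9 * T * T + + 9 * (T * T))
    isolate = solve-∀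
    factor : ∀ s q → + 9 * + 9 * s - + 9 * + 9 * q ≡ + 9 * (+ 9 * (s - q))
    factor = solve-∀

  3∣T : + 3 ∣ T
  3∣T = prime∣square⇒prime∣ (from-yes (prime? 3)) T
    (divides (+ 3 * (t · t - Q G x)) (trans T²≡9[t·t-Qx] (reassoc (t · t - Q G x))))
    where
    reassoc : ∀ s → + 9 * s ≡ + 3 * s * + 3
    reassoc = solve-∀

  module _ (T′ : ℤ) (T≡3T′ : T ≡ T′ * + 3) where

    ê : A8
    ê = affine (+ 3) T′ t , (begin
      Σℤ (affine (+ 3) T′ t)     ≡⟨ Σℤ-affine (+ 3) T′ t ⟩
      + 3 * T - + 9 * T′        ≡⟨ cong (λ s → + 3 * s - + 9 * T′) T≡3T′ ⟩
      + 3 * (T′ * + 3) - + 9 * T′ ≡⟨ cancel T′ ⟩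
      0ℤ                        ∎)
      where
      cancel : ∀ s → + 3 * (s * + 3) - + 9 * s ≡ 0ℤ
      cancel = solve-∀

    σê≡3x : σ ê ≡ (+ 3) ·ᵥ x
    σê≡3x = ·ᵥ-cancel (+ 3) (λ ()) _ _ (begin
      (+ 3) ·ᵥ σ ê             ≡⟨ σ-* (+ 3) ê ⟨
      σ ((+ 3) *ᴬ ê)           ≡⟨ σ-cong (lookup-ext 3ê≡u) ⟩
      σ u                      ≡⟨ σu≡9x ⟩
      (+ 9) ·ᵥ x               ≡⟨ ·ᵥ-assoc (+ 3) (+ 3) x ⟨
      (+ 3) ·ᵥ ((+ 3) ·ᵥ x)    ∎)
      where
      3ê≡u : ∀ i → lookup ((+ 3) ·ᵥ proj₁ ê) i ≡ lookup (proj₁ u) i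
      3ê≡u i = begin
        lookup ((+ 3) ·ᵥ proj₁ ê) i       ≡⟨ trans (lookup-·ᵥ (+ 3) (proj₁ ê) i) (cong (+ 3 *_) (lookup-affine (+ 3) T′ t i)) ⟩
        + 3 * (+ 3 * lookup t i - T′)     ≡⟨ expand (lookup t i) T′ ⟩
        + 9 * lookup t i - T′ * + 3       ≡⟨ cong (_-_ (+ 9 * lookup t i)) T≡3T′ ⟨
        + 9 * lookup t i - T              ≡⟨ lookup-affine (+ 9) T t i ⟨
        lookup (proj₁ u) i                ∎
        where
        expand : ∀ s T′ → + 3 * (+ 3 * s - T′) ≡ + 9 * s - T′ * + 3
        expand = solve-∀

    in-image : ∀ s → T′ ≡ s * + 3 → ∃[ b ] σ b ≡ x
    in-image s T′≡3s = b , ·ᵥ-cancel (+ 3) (λ ()) _ _ (begin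
      (+ 3) ·ᵥ σ b             ≡⟨ σ-* (+ 3) b ⟨
      σ ((+ 3) *ᴬ b)           ≡⟨ σ-cong (lookup-ext 3b≡ê) ⟩
      σ ê                      ≡⟨ σê≡3x ⟩
      (+ 3) ·ᵥ x               ∎)
      where
      b : A8
      b = affine 1ℤ s t , (begin
        Σℤ (affine 1ℤ s t)         ≡⟨ Σℤ-affine 1ℤ s t ⟩
        1ℤ * T - + 9 * s          ≡⟨ cong (λ w → 1ℤ * w - + 9 * s) (trans T≡3T′ (cong (_* + 3) T′≡3s)) ⟩
        1ℤ * (s * + 3 * + 3) - + 9 * s ≡⟨ cancel s ⟩
        0ℤ                        ∎)
        where
        cancel : ∀ s → 1ℤ * (s * + 3 * + 3) - + 9 * s ≡ 0ℤ
        cancel = solve-∀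
      3b≡ê : ∀ i → lookup ((+ 3) ·ᵥ proj₁ b) i ≡ lookup (proj₁ ê) i
      3b≡ê i = begin
        lookup ((+ 3) ·ᵥ proj₁ b) i       ≡⟨ trans (lookup-·ᵥ (+ 3) (proj₁ b) i) (cong (+ 3 *_) (lookup-affine 1ℤ s t i)) ⟩
        + 3 * (1ℤ * lookup t i - s)       ≡⟨ expand (lookup t i) s ⟩
        + 3 * lookup t i - s * + 3        ≡⟨ cong (_-_ (+ 3 * lookup t i)) T′≡3s ⟨
        + 3 * lookup t i - T′             ≡⟨ lookup-affine (+ 3) T′ t i ⟨
        lookup (proj₁ ê) i                ∎
        where
        expand : ∀ r s → + 3 * (1ℤ * r - s) ≡ + 3 * r - s * + 3
        expand = solve-∀

    glue-correction : ℤ → ℤ → ℤ^ 9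
    glue-correction ε s = zipWith (λ tᵢ gᵢ → ε * (s - tᵢ) - gᵢ) t γ-offset

    γ-decomposition : ∀ ε s → ε * (+ 3 * s - T′) ≡ 1ℤ → proj₁ γ ≡ (ε ·ᵥ proj₁ ê) ⊞ ((+ 3) ·ᵥ glue-correction ε s)
    γ-decomposition ε s ε[3s-T′]≡1 = lookup-ext λ i → begin
      lookup (proj₁ γ) i                                       ≡⟨ lookup-γ i ⟩
      1ℤ - + 3 * lookup γ-offset i                             ≡⟨ cong (λ w → w - + 3 * lookup γ-offset i) ε[3s-T′]≡1 ⟨
      ε * (+ 3 * s - T′) - + 3 * lookup γ-offset i             ≡⟨ regroup ε s T′ (lookup t i) (lookup γ-offset i) ⟩
      ε * (+ 3 * lookup t i - T′) + + 3 * (ε * (s - lookup t i) - lookup γ-offset i)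
                                                               ≡⟨ cong₂ (λ p q → ε * p + + 3 * q) (lookup-affine (+ 3) T′ t i)
                                                                    (lookup-zipWith (λ tᵢ gᵢ → ε * (s - tᵢ) - gᵢ) i t γ-offset) ⟨
      ε * lookup (proj₁ ê) i + + 3 * lookup f i                ≡⟨ cong₂ _+_ (lookup-·ᵥ ε (proj₁ ê) i) (lookup-·ᵥ (+ 3) f i) ⟨
      lookup (ε ·ᵥ proj₁ ê) i + lookup ((+ 3) ·ᵥ f) i          ≡⟨ lookup-⊞ (ε ·ᵥ proj₁ ê) ((+ 3) ·ᵥ f) i ⟨
      lookup ((ε ·ᵥ proj₁ ê) ⊞ ((+ 3) ·ᵥ f)) i                 ∎
      where
      f : ℤ^ 9
      f = glue-correction ε s
      regroup : ∀ ε s T′ r g → ε * (+ 3 * s - T′) - + 3 * g ≡ ε * (+ 3 * r - T′) + + 3 * (ε * (s - r) - g)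
      regroup = solve-∀

    third-of-γ : ∀ ε s → ε * (+ 3 * s - T′) ≡ 1ℤ → ∃[ z ] (+ 3) ·ᵥ z ≡ σ γ
    third-of-γ ε s ε[3s-T′]≡1 = (ε ·ᵥ x) ⊞ σ f , (begin
      (+ 3) ·ᵥ ((ε ·ᵥ x) ⊞ σ f)                  ≡⟨ ·ᵥ-distribˡ (+ 3) (ε ·ᵥ x) (σ f) ⟩
      ((+ 3) ·ᵥ (ε ·ᵥ x)) ⊞ ((+ 3) ·ᵥ σ f)       ≡⟨ cong₂ _⊞_ (·ᵥ-comm (+ 3) ε x) (sym (σ-* (+ 3) f)) ⟩
      (ε ·ᵥ ((+ 3) ·ᵥ x)) ⊞ σ ((+ 3) *ᴬ f)       ≡⟨ cong (λ y → (ε ·ᵥ y) ⊞ σ ((+ 3) *ᴬ f)) σê≡3x ⟨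
      (ε ·ᵥ σ ê) ⊞ σ ((+ 3) *ᴬ f)                ≡⟨ cong (_⊞ σ ((+ 3) *ᴬ f)) (σ-* ε ê) ⟨
      σ (ε *ᴬ ê) ⊞ σ ((+ 3) *ᴬ f)                ≡⟨ σ-+ (ε *ᴬ ê) ((+ 3) *ᴬ f) ⟨
      σ (ε *ᴬ ê +ᴬ (+ 3) *ᴬ f)                   ≡⟨ σ-cong (sym decomposition) ⟩
      σ γ                                        ∎)
      where
      decomposition : proj₁ γ ≡ (ε ·ᵥ proj₁ ê) ⊞ ((+ 3) ·ᵥ glue-correction ε s)
      decomposition = γ-decomposition ε s ε[3s-T′]≡1
      f : A8
      f = glue-correction ε s , sum-zero-quotient (+ 3) ε γ ê (glue-correction ε s) (λ ()) decomposition

  in-image-or-third-of-γ : (∃[ b ] σ b ≡ x) ⊎ (∃[ z ] (+ 3) ·ᵥ z ≡ σ γ)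
  in-image-or-third-of-γ =
    [ (λ (q , T′≡3q) → inj₁ (in-image T′ T≡3T′ q T′≡3q))
    , (λ (ε , s , ε[3s-T′]≡1) → inj₂ (third-of-γ T′ T≡3T′ ε s ε[3s-T′]≡1))
    ]′ (three-divides-or-unit-residue T′)
    where
    open _∣_ 3∣T renaming (quotient to T′; equality to T≡3T′)

E8⁻¹ : Gram 8
E8⁻¹ i j = lookup (lookup rows i) j
  where
  rows : Vec (Vec ℤ 8) 8
  rows =
    (+ 4 ∷ + 5 ∷ + 7 ∷ + 10 ∷ + 8 ∷ + 6 ∷ + 4 ∷ + 2 ∷ []) ∷
    (+ 5 ∷ + 8 ∷ + 10 ∷ + 15 ∷ + 12 ∷ + 9 ∷ + 6 ∷ + 3 ∷ []) ∷
    (+ 7 ∷ + 10 ∷ + 14 ∷ + 20 ∷ + 16 ∷ + 12 ∷ + 8 ∷ + 4 ∷ []) ∷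
    (+ 10 ∷ + 15 ∷ + 20 ∷ + 30 ∷ + 24 ∷ + 18 ∷ + 12 ∷ + 6 ∷ []) ∷
    (+ 8 ∷ + 12 ∷ + 16 ∷ + 24 ∷ + 20 ∷ + 15 ∷ + 10 ∷ + 5 ∷ []) ∷
    (+ 6 ∷ + 9 ∷ + 12 ∷ + 18 ∷ + 15 ∷ + 12 ∷ + 8 ∷ + 4 ∷ []) ∷
    (+ 4 ∷ + 6 ∷ + 8 ∷ + 12 ∷ + 10 ∷ + 8 ∷ + 6 ∷ + 3 ∷ []) ∷
    (+ 2 ∷ + 3 ∷ + 4 ∷ + 6 ∷ + 5 ∷ + 4 ∷ + 3 ∷ + 2 ∷ []) ∷
    []

E8-integralInverse : IntegralInverse E8
E8-integralInverse = record
  { inverse       = E8⁻¹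
  ; inverse-left  = toWitness {a? = all? λ i → all? λ j → ∑[ l < 8 ] (E8⁻¹ i l * E8 l j) ℤ.≟ δ i j} _
  ; inverse-right = toWitness {a? = all? λ i → all? λ j → ∑[ l < 8 ] (E8 i l * E8⁻¹ l j) ℤ.≟ δ i j} _
  }

-- Basis vector i of the copy of E8 is E8-glue i · z + σ (E8-root i), where 3z = σ γ: node 2 of
-- the Bourbaki diagram is z, the others are the roots e₆−e₇, e₇−e₈, e₈−e₀, e₀−e₁, …, e₃−e₄.
E8-glue : Fin 8 → ℤ
E8-glue (suc zero) = 1ℤ
E8-glue _          = 0ℤ

E8-root : Fin 8 → A8
E8-root zero                                      = (0ℤ ∷ 0ℤ ∷ 0ℤ ∷ 0ℤ ∷ 0ℤ ∷ 0ℤ ∷ 1ℤ ∷ -1ℤ ∷ 0ℤ ∷ []) , refl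
E8-root (suc zero)                                = (0ℤ ∷ 0ℤ ∷ 0ℤ ∷ 0ℤ ∷ 0ℤ ∷ 0ℤ ∷ 0ℤ ∷ 0ℤ ∷ 0ℤ ∷ []) , refl
E8-root (suc (suc zero))                          = (0ℤ ∷ 0ℤ ∷ 0ℤ ∷ 0ℤ ∷ 0ℤ ∷ 0ℤ ∷ 0ℤ ∷ 1ℤ ∷ -1ℤ ∷ []) , refl
E8-root (suc (suc (suc zero)))                    = (-1ℤ ∷ 0ℤ ∷ 0ℤ ∷ 0ℤ ∷ 0ℤ ∷ 0ℤ ∷ 0ℤ ∷ 0ℤ ∷ 1ℤ ∷ []) , refl
E8-root (suc (suc (suc (suc zero))))              = (1ℤ ∷ -1ℤ ∷ 0ℤ ∷ 0ℤ ∷ 0ℤ ∷ 0ℤ ∷ 0ℤ ∷ 0ℤ ∷ 0ℤ ∷ []) , refl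
E8-root (suc (suc (suc (suc (suc zero)))))        = (0ℤ ∷ 1ℤ ∷ -1ℤ ∷ 0ℤ ∷ 0ℤ ∷ 0ℤ ∷ 0ℤ ∷ 0ℤ ∷ 0ℤ ∷ []) , refl
E8-root (suc (suc (suc (suc (suc (suc zero))))))  = (0ℤ ∷ 0ℤ ∷ 1ℤ ∷ -1ℤ ∷ 0ℤ ∷ 0ℤ ∷ 0ℤ ∷ 0ℤ ∷ 0ℤ ∷ []) , refl
E8-root (suc (suc (suc (suc (suc (suc (suc zero)))))))
                                                  = (0ℤ ∷ 0ℤ ∷ 0ℤ ∷ 1ℤ ∷ -1ℤ ∷ 0ℤ ∷ 0ℤ ∷ 0ℤ ∷ 0ℤ ∷ []) , refl

E8-tripled : Fin 8 → A8
E8-tripled i = E8-glue i *ᴬ γ +ᴬ (+ 3) *ᴬ E8-root i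

E8-tripled-gram : ∀ i j → proj₁ (E8-tripled i) · proj₁ (E8-tripled j) ≡ + 9 * E8 i j
E8-tripled-gram = toWitness {a? = all? λ i → all? λ j → proj₁ (E8-tripled i) · proj₁ (E8-tripled j) ℤ.≟ + 9 * E8 i j} _

module E8Sublattice {n} (G : Gram n) (G-sym : IsSymmetric G) (σ : A8 → ℤ^ n) (σ-rep : IsRepA8 G σ)
  (z : ℤ^ n) (3z≡σγ : (+ 3) ·ᵥ z ≡ σ γ) where

  open A8Representation G G-sym σ σ-rep

  v : Fin 8 → ℤ^ n
  v i = (E8-glue i ·ᵥ z) ⊞ σ (E8-root i)

  3v≡σ : ∀ i → (+ 3) ·ᵥ v i ≡ σ (E8-tripled i)
  3v≡σ i = begin
    (+ 3) ·ᵥ ((c ·ᵥ z) ⊞ σ ρ)                 ≡⟨ ·ᵥ-distribˡ (+ 3) (c ·ᵥ z) (σ ρ) ⟩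
    ((+ 3) ·ᵥ (c ·ᵥ z)) ⊞ ((+ 3) ·ᵥ σ ρ)      ≡⟨ cong₂ _⊞_ (·ᵥ-comm (+ 3) c z) (sym (σ-* (+ 3) ρ)) ⟩
    (c ·ᵥ ((+ 3) ·ᵥ z)) ⊞ σ ((+ 3) *ᴬ ρ)      ≡⟨ cong (λ y → (c ·ᵥ y) ⊞ σ ((+ 3) *ᴬ ρ)) 3z≡σγ ⟩
    (c ·ᵥ σ γ) ⊞ σ ((+ 3) *ᴬ ρ)               ≡⟨ cong (_⊞ σ ((+ 3) *ᴬ ρ)) (σ-* c γ) ⟨
    σ (c *ᴬ γ) ⊞ σ ((+ 3) *ᴬ ρ)               ≡⟨ σ-+ (c *ᴬ γ) ((+ 3) *ᴬ ρ) ⟨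
    σ (E8-tripled i)                           ∎
    where
    c : ℤ
    c = E8-glue i
    ρ : A8
    ρ = E8-root i

  v-gram : ∀ i j → B G (v i) (v j) ≡ E8 i j
  v-gram i j = *-cancelˡ-≡ (+ 9) _ _ (trans (scaled-B (+ 3) (E8-tripled i) (E8-tripled j) (3v≡σ i) (3v≡σ j)) (E8-tripled-gram i j))

lemma3p5 : ∀ (n : ℕ) (G : Gram n) → IsIntegralLattice G → RepresentsA8Imprimitively G →
  ∃[ m ] Σ (Gram m) λ N → IsIntegralLattice N × Isometric G (E8 ⊥ᴳ N)
lemma3p5 n G G-lattice (σ , σ-rep , x , k , k≢0 , (a , σa≡kx) , x∉σA8) =
  [ (λ x∈σA8 → ⊥-elim (x∉σA8 x∈σA8))
  , (λ (z , 3z≡σγ) → let open E8Sublattice G (proj₁ G-lattice) σ σ-rep z 3z≡σγ in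
                     split-unimodular G G-lattice E8 E8-integralInverse v v-gram)
  ]′ (Saturation.in-image-or-third-of-γ G (proj₁ G-lattice) σ σ-rep x k k≢0 a σa≡kx)
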